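{- Let $a,b\ge1$ and let $G$ be a finite $(a,b)$-biregular bipartite graph on $N$ vertices with bipartition classes $\mathcal{E}_G,\mathcal{O}_G$, let $H$ be any finite graph (loops allowed), and let $(\Lambda,\mathrm{M})=((\lambda_i,\mu_i))_{i\in V(H)}$ be any system of pairs of positive real activities on $V(H)$. Then $$Z^{(\Lambda,\mathrm{M})}(G,H) \leq \left(Z^{(\Lambda,\mathrm{M})}(K_{a,b},H)\right)^{N/(a+b)}.$$
   Context: A bipartite graph $G$ with bipartition classes $\mathcal{E}_G,\mathcal{O}_G$ (every edge joins the two classes) is $(a,b)$-biregular if every vertex of $\mathcal{E}_G$ has degree $a$ and every vertex of $\mathcal{O}_G$ has degree $b$. $K_{a,b}$ denotes the complete bipartite graph considered as $(a,b)$-biregular, i.e. with class $\mathcal{E}$ consisting of $b$ vertices (each of degree $a$) and class $\mathcal{O}$ consisting of $a$ vertices (each of degree $b$). Graphs $H$ are finite, undirected, without multiple edges, and may have loops. $\mathrm{Hom}(G,H)=\{f:V(G)\to V(H) : u\sim v \Rightarrow f(u)\sim f(v)\}$. Each $f\in\mathrm{Hom}(G,H)$ has weight $w^{(\Lambda,\mathrm{M})}(f)=\prod_{v\in\mathcal{E}_G}\lambda_{f(v)}\prod_{v\in\mathcal{O}_G}\mu_{f(v)}$, and $Z^{(\Lambda,\mathrm{M})}(G,H)=\sum_{f\in\mathrm{Hom}(G,H)}w^{(\Lambda,\mathrm{M})}(f)$. -}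

module Defs where

open import Data.Nat as ℕ using (ℕ; zero; suc)
open import Data.Fin using (Fin; zero; suc)
open import Data.Bool using (Bool; true; false; _∧_; _∨_; not; T)
open import Data.Product using (Σ; ∃; _×_; _,_)
open import Data.Sum using (_⊎_)
open import Relation.Binary.PropositionalEquality using (_≡_; _≢_)
open import Relation.Binary.Structures using (IsStrictTotalOrder)
open import Algebra.Structures using (IsCommutativeRing)

-- The real numbers, axiomatised as a complete ordered field
-- (unique up to isomorphism; the statement quantifies over every model).

record CompleteOrderedField : Set₁ where
  infixl 6 _+_
  infixl 7 _*_
  infix 4 _<_ _≤_
  field
    Carrier : Set
    _+_ _*_ : Carrier → Carrier → Carrier
    -_ : Carrier → Carrier
    0# 1# : Carrier
    _<_ : Carrier → Carrier → Set
    isCommutativeRing : IsCommutativeRing _≡_ _+_ _*_ -_ 0# 1#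
    0≢1 : 0# ≢ 1#
    inverse : ∀ x → x ≢ 0# → Σ Carrier λ y → x * y ≡ 1#
    isStrictTotalOrder : IsStrictTotalOrder _≡_ _<_
    +-mono-< : ∀ {x y} z → x < y → x + z < y + z
    *-pos : ∀ {x y} → 0# < x → 0# < y → 0# < x * y

  _≤_ : Carrier → Carrier → Set
  x ≤ y = x < y ⊎ x ≡ y

  field
    supremum : (P : Carrier → Set) → Σ Carrier P →
               Σ Carrier (λ u → ∀ x → P x → x ≤ u) →
               Σ Carrier λ s → (∀ x → P x → x ≤ s) ×
                               (∀ u → (∀ x → P x → x ≤ u) → s ≤ u)

module _ (R : CompleteOrderedField) where
  open CompleteOrderedField R

  ∑ : (n : ℕ) → (Fin n → Carrier) → Carrier
  ∑ zero f = 0#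
  ∑ (suc n) f = f zero + ∑ n (λ i → f (suc i))

  ∏ : (n : ℕ) → (Fin n → Carrier) → Carrier
  ∏ zero f = 1#
  ∏ (suc n) f = f zero * ∏ n (λ i → f (suc i))

  _^_ : Carrier → ℕ → Carrier
  x ^ zero = 1#
  x ^ suc n = x * (x ^ n)

  ∑Fun : (n h : ℕ) → ((Fin n → Fin h) → Carrier) → Carrier
  ∑Fun zero h F = F (λ ())
  ∑Fun (suc n) h F =
    ∑ h (λ i → ∑Fun n h (λ g → F (λ { zero → i ; (suc k) → g k })))

allB : (n : ℕ) → (Fin n → Bool) → Bool
allB zero p = true
allB (suc n) p = p zero ∧ allB n (λ i → p (suc i))

countB : (n : ℕ) → (Fin n → Bool) → ℕ
countB zero p = 0
countB (suc n) p = (if p zero then 1 else 0) ℕ.+ countB n (λ i → p (suc i))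
  where open import Data.Bool using (if_then_else_)

record BipGraph : Set where
  field
    nE nO : ℕ
    adj : Fin nE → Fin nO → Bool

open BipGraph public

IsBiregular : ℕ → ℕ → BipGraph → Set
IsBiregular a b G =
  (∀ e → countB (nO G) (λ o → adj G e o) ≡ a) ×
  (∀ o → countB (nE G) (λ e → adj G e o) ≡ b)

∣V∣ : BipGraph → ℕ
∣V∣ G = nE G ℕ.+ nO G

-- K_{a,b} as (a,b)-biregular: E has b vertices (degree a), O has a vertices.
K : ℕ → ℕ → BipGraph
K a b = record { nE = b ; nO = a ; adj = λ _ _ → true }

record Graph : Set where
  field
    size : ℕ
    adjH : Fin size → Fin size → Bool
    symmetric : ∀ i j → adjH i j ≡ adjH j i

open Graph public

isHom : (G : BipGraph) (H : Graph) →
        (Fin (nE G) → Fin (size H)) → (Fin (nO G) → Fin (size H)) → Bool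
isHom G H fE fO =
  allB (nE G) λ e → allB (nO G) λ o → not (adj G e o) ∨ adjH H (fE e) (fO o)

Z : (R : CompleteOrderedField) → (G : BipGraph) → (H : Graph) →
    (Fin (size H) → CompleteOrderedField.Carrier R) →
    (Fin (size H) → CompleteOrderedField.Carrier R) →
    CompleteOrderedField.Carrier R
Z R G H lam mu =
  ∑Fun R (nE G) (size H) λ fE →
  ∑Fun R (nO G) (size H) λ fO →
    if isHom G H fE fO
    then ∏ R (nE G) (λ e → lam (fE e)) * ∏ R (nO G) (λ o → mu (fO o))
    else 0#
  where
    open CompleteOrderedField R
    open import Data.Bool using (if_then_else_)

-- Write Z(G,H) as a sum over colourings x of the class O, weighted by ∏ μ(x o), of the product
-- over the vertices e of E of L_e(x), the λ-weight of the colours available to e; L_e(x) only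
-- depends on the colours of the neighbours of e.  Every vertex of O lies in exactly b of these
-- neighbourhoods, so Finner's generalised Hölder inequality bounds Z(G,H)^b by the product of the
-- b-th moments of the L_e, and expanding the b-th power shows that each such moment is Z(K_{a,b},H)
-- up to powers of the total mass ∑ μ.  Counting edges, a |E| = b |O|, turns
-- Z(G,H)^b ≤ Z(K_{a,b},H)^|E| into the claim.  Finner's inequality is proved by integrating out one
-- coordinate at a time with Hölder's inequality, which follows from AM–GM after normalising; the
-- roots this needs exist because the field is complete.

module Submission where

open import Defs hiding (∑; ∏; _^_; ∑Fun)
import Defs
open import Data.Nat as ℕ using (ℕ; zero; suc; s≤s; z≤n)
import Data.Nat.Properties as ℕₚ
open import Data.Fin using (Fin; zero; suc)
open import Data.Bool using (Bool; true; false; if_then_else_; _∨_; not)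
open import Data.Product using (Σ; _×_; _,_; proj₁; proj₂)
open import Data.Sum using (inj₁; inj₂)
open import Data.Empty using (⊥; ⊥-elim)
open import Function using (_∘_)
open import Data.Vec.Functional using (_∷_)
open import Relation.Nullary using (¬_; Dec; yes; no; contradiction)
open import Relation.Nullary.Decidable using (_×-dec_)
import Data.Bool.Properties as Boolₚ
import Data.Fin.Properties as Finₚ
open import Relation.Binary.PropositionalEquality
open import Relation.Binary.Definitions using (tri<; tri≈; tri>)
open import Relation.Binary.Bundles using (StrictPartialOrder)
open import Relation.Binary.Structures using (IsStrictTotalOrder)
open import Algebra.Bundles using (CommutativeRing)
import Relation.Binary.Construct.StrictToNonStrict as StrictToNonStrict
import Relation.Binary.Reasoning.StrictPartialOrder as StrictPartialOrderReasoning
import Algebra.Properties.Ring as RingProperties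
import Algebra.Definitions.RawMonoid as Multiples
import Algebra.Solver.Ring.NaturalCoefficients.Default as NaturalCoefficientsSolver
import Algebra.Properties.CommutativeMonoid.Sum as CommutativeMonoidSum

module OrderedField (R : CompleteOrderedField) where
  open CompleteOrderedField R public
  open IsStrictTotalOrder isStrictTotalOrder public
    using (compare; _≟_; isStrictPartialOrder; <-respʳ-≈; <-respˡ-≈)
    renaming (trans to <-trans; irrefl to <-irrefl; asym to <-asym)

  commutativeRing : CommutativeRing _ _
  commutativeRing = record { isCommutativeRing = isCommutativeRing }

  open CommutativeRing commutativeRing public
    using ( +-comm; +-assoc; +-identityˡ; +-identityʳ; -‿inverseˡ; -‿inverseʳ
          ; *-comm; *-assoc; *-identityˡ; *-identityʳ; distribˡ; distribʳ; zeroˡ; zeroʳ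
          ; commutativeSemiring; ring; +-rawMonoid)
  open RingProperties ring public using (-‿distribˡ-*; -‿distribʳ-*; -‿involutive)
  open NaturalCoefficientsSolver commutativeSemiring public using (solve; _:+_; _:*_; _:=_; con)

  fromℕ : ℕ → Carrier
  fromℕ n = Multiples._×_ +-rawMonoid n 1#

  strictPartialOrder : StrictPartialOrder _ _ _
  strictPartialOrder = record { isStrictPartialOrder = isStrictPartialOrder }

  module ≤-Reasoning = StrictPartialOrderReasoning strictPartialOrder

  private module NS = StrictToNonStrict _≡_ _<_

  ≤-refl : ∀ {x} → x ≤ x
  ≤-refl = inj₂ refl

  ≤-reflexive : ∀ {x y} → x ≡ y → x ≤ y
  ≤-reflexive = inj₂

  <⇒≤ : ∀ {x y} → x < y → x ≤ y
  <⇒≤ = inj₁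

  ≤-trans : ∀ {x y z} → x ≤ y → y ≤ z → x ≤ z
  ≤-trans = NS.trans isEquivalence (<-respʳ-≈ , <-respˡ-≈) <-trans

  <-≤-trans : ∀ {x y z} → x < y → y ≤ z → x < z
  <-≤-trans = NS.<-≤-trans <-trans <-respʳ-≈

  ≤-<-trans : ∀ {x y z} → x ≤ y → y < z → x < z
  ≤-<-trans = NS.≤-<-trans sym <-trans <-respˡ-≈

  ≤-antisym : ∀ {x y} → x ≤ y → y ≤ x → x ≡ y
  ≤-antisym = NS.antisym isEquivalence <-trans <-irrefl

  ≤⇒≯ : ∀ {x y} → x ≤ y → ¬ (y < x)
  ≤⇒≯ p q = <-irrefl refl (≤-<-trans p q)

  ≮⇒≥ : ∀ {x y} → ¬ (x < y) → y ≤ x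
  ≮⇒≥ {x} {y} x≮y with compare x y
  ... | tri< x<y _ _ = ⊥-elim (x≮y x<y)
  ... | tri≈ _ x≡y _ = inj₂ (sym x≡y)
  ... | tri> _ _ y<x = inj₁ y<x

  ≰⇒> : ∀ {x y} → ¬ (x ≤ y) → y < x
  ≰⇒> {x} {y} x≰y with compare x y
  ... | tri< x<y _ _ = ⊥-elim (x≰y (inj₁ x<y))
  ... | tri≈ _ x≡y _ = ⊥-elim (x≰y (inj₂ x≡y))
  ... | tri> _ _ y<x = y<x

  +-monoʳ-< : ∀ z {x y} → x < y → z + x < z + y
  +-monoʳ-< z {x} {y} x<y = subst₂ _<_ (+-comm x z) (+-comm y z) (+-mono-< z x<y)

  +-monoˡ-≤ : ∀ z {x y} → x ≤ y → x + z ≤ y + z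
  +-monoˡ-≤ z (inj₁ x<y) = inj₁ (+-mono-< z x<y)
  +-monoˡ-≤ z (inj₂ refl) = ≤-refl

  +-monoʳ-≤ : ∀ z {x y} → x ≤ y → z + x ≤ z + y
  +-monoʳ-≤ z {x} {y} x≤y = subst₂ _≤_ (+-comm x z) (+-comm y z) (+-monoˡ-≤ z x≤y)

  +-mono-≤ : ∀ {x y u v} → x ≤ y → u ≤ v → x + u ≤ y + v
  +-mono-≤ {y = y} {u} x≤y u≤v = ≤-trans (+-monoˡ-≤ u x≤y) (+-monoʳ-≤ y u≤v)

  +-mono-<-≤ : ∀ {x y u v} → x < y → u ≤ v → x + u < y + v
  +-mono-<-≤ {y = y} {u} x<y u≤v = <-≤-trans (+-mono-< u x<y) (+-monoʳ-≤ y u≤v)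

  +-cancelʳ-≤ : ∀ z {x y} → x + z ≤ y + z → x ≤ y
  +-cancelʳ-≤ z x+z≤y+z = ≮⇒≥ (λ y<x → ≤⇒≯ x+z≤y+z (+-mono-< z y<x))

  +-cancelʳ-< : ∀ z {x y} → x + z < y + z → x < y
  +-cancelʳ-< z x+z<y+z = ≰⇒> (λ y≤x → ≤⇒≯ (+-monoˡ-≤ z y≤x) x+z<y+z)

  +-nonNeg : ∀ {x y} → 0# ≤ x → 0# ≤ y → 0# ≤ x + y
  +-nonNeg 0≤x 0≤y = subst (_≤ _) (+-identityˡ 0#) (+-mono-≤ 0≤x 0≤y)

  x≤x+y : ∀ x {y} → 0# ≤ y → x ≤ x + y
  x≤x+y x {y} 0≤y = subst (_≤ x + y) (+-identityʳ x) (+-monoʳ-≤ x 0≤y)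

  y≤x+y : ∀ {x} y → 0# ≤ x → y ≤ x + y
  y≤x+y {x} y 0≤x = subst (_≤ x + y) (+-identityˡ y) (+-monoˡ-≤ y 0≤x)

  x<x+y : ∀ x {y} → 0# < y → x < x + y
  x<x+y x {y} 0<y = subst (_< x + y) (+-identityʳ x) (+-monoʳ-< x 0<y)

  x-y+y≡x : ∀ x y → x + - y + y ≡ x
  x-y+y≡x x y = trans (+-assoc x (- y) y) (trans (cong (x +_) (-‿inverseˡ y)) (+-identityʳ x))

  <⇒0<- : ∀ {x y} → x < y → 0# < y + - x
  <⇒0<- {x} x<y = subst (_< _) (-‿inverseʳ x) (+-mono-< (- x) x<y)

  0<-⇒< : ∀ {x y} → 0# < y + - x → x < y
  0<-⇒< {x} {y} 0<y-x = subst₂ _<_ (+-identityˡ x) (x-y+y≡x y x) (+-mono-< x 0<y-x)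

  neg-pos : ∀ {x} → x < 0# → 0# < - x
  neg-pos {x} x<0 = subst₂ _<_ (-‿inverseʳ x) (+-identityˡ (- x)) (+-mono-< (- x) x<0)

  -x*-x≡x*x : ∀ x → - x * - x ≡ x * x
  -x*-x≡x*x x =
    trans (sym (-‿distribˡ-* x (- x))) (trans (cong -_ (sym (-‿distribʳ-* x x))) (-‿involutive (x * x)))

  0<1 : 0# < 1#
  0<1 with compare 0# 1#
  ... | tri< 0<1 _ _ = 0<1
  ... | tri≈ _ 0≡1 _ = ⊥-elim (0≢1 0≡1)
  ... | tri> _ _ 1<0 =
    ⊥-elim (<-asym 1<0 (subst (0# <_) (trans (-x*-x≡x*x 1#) (*-identityˡ 1#))
                               (*-pos (neg-pos 1<0) (neg-pos 1<0))))

  0≤1 : 0# ≤ 1#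
  0≤1 = inj₁ 0<1

  *-monoˡ-<-pos : ∀ {z x y} → 0# < z → x < y → x * z < y * z
  *-monoˡ-<-pos {z} {x} {y} 0<z x<y = 0<-⇒< (subst (0# <_) difference (*-pos (<⇒0<- x<y) 0<z))
    where
    difference : (y + - x) * z ≡ y * z + - (x * z)
    difference = trans (distribʳ z y (- x)) (cong (y * z +_) (sym (-‿distribˡ-* x z)))

  *-monoʳ-<-pos : ∀ {z x y} → 0# < z → x < y → z * x < z * y
  *-monoʳ-<-pos {z} {x} {y} 0<z x<y = subst₂ _<_ (*-comm x z) (*-comm y z) (*-monoˡ-<-pos 0<z x<y)

  *-monoˡ-≤-nonNeg : ∀ {z x y} → 0# ≤ z → x ≤ y → x * z ≤ y * z
  *-monoˡ-≤-nonNeg (inj₁ 0<z) (inj₁ x<y) = inj₁ (*-monoˡ-<-pos 0<z x<y)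
  *-monoˡ-≤-nonNeg (inj₁ 0<z) (inj₂ refl) = ≤-refl
  *-monoˡ-≤-nonNeg {x = x} {y} (inj₂ refl) _ = inj₂ (trans (zeroʳ x) (sym (zeroʳ y)))

  *-monoʳ-≤-nonNeg : ∀ {z x y} → 0# ≤ z → x ≤ y → z * x ≤ z * y
  *-monoʳ-≤-nonNeg {z} {x} {y} 0≤z x≤y = subst₂ _≤_ (*-comm x z) (*-comm y z) (*-monoˡ-≤-nonNeg 0≤z x≤y)

  *-nonNeg : ∀ {x y} → 0# ≤ x → 0# ≤ y → 0# ≤ x * y
  *-nonNeg {y = y} 0≤x 0≤y = subst (_≤ _) (zeroˡ y) (*-monoˡ-≤-nonNeg 0≤y 0≤x)

  *-mono-≤-nonNeg : ∀ {x y u v} → 0# ≤ x → 0# ≤ u → x ≤ y → u ≤ v → x * u ≤ y * v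
  *-mono-≤-nonNeg 0≤x 0≤u x≤y u≤v =
    ≤-trans (*-monoˡ-≤-nonNeg 0≤u x≤y) (*-monoʳ-≤-nonNeg (≤-trans 0≤x x≤y) u≤v)

  *-cancelʳ-≤-pos : ∀ {z x y} → 0# < z → x * z ≤ y * z → x ≤ y
  *-cancelʳ-≤-pos 0<z xz≤yz = ≮⇒≥ (λ y<x → ≤⇒≯ xz≤yz (*-monoˡ-<-pos 0<z y<x))

  *-cancelˡ-≤-pos : ∀ {z x y} → 0# < z → z * x ≤ z * y → x ≤ y
  *-cancelˡ-≤-pos {z} {x} {y} 0<z zx≤zy = *-cancelʳ-≤-pos 0<z (subst₂ _≤_ (*-comm z x) (*-comm z y) zx≤zy)

  *-cancelʳ-<-pos : ∀ {z x y} → 0# < z → x * z < y * z → x < y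
  *-cancelʳ-<-pos 0<z xz<yz = ≰⇒> (λ y≤x → ≤⇒≯ (*-monoˡ-≤-nonNeg (inj₁ 0<z) y≤x) xz<yz)

  square-nonNeg : ∀ x → 0# ≤ x * x
  square-nonNeg x with compare 0# x
  ... | tri< 0<x _ _ = inj₁ (*-pos 0<x 0<x)
  ... | tri≈ _ refl _ = inj₂ (sym (zeroˡ 0#))
  ... | tri> _ _ x<0 = inj₁ (subst (0# <_) (-x*-x≡x*x x) (*-pos (neg-pos x<0) (neg-pos x<0)))

  pos-*-nonNeg≡0 : ∀ {x y} → 0# < x → 0# ≤ y → x * y ≡ 0# → y ≡ 0#
  pos-*-nonNeg≡0 0<x (inj₁ 0<y) xy≡0 = ⊥-elim (<-irrefl (sym xy≡0) (*-pos 0<x 0<y))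
  pos-*-nonNeg≡0 0<x (inj₂ 0≡y) xy≡0 = sym 0≡y

  _⁻¹ : ∀ {x} → 0# < x → Carrier
  0<x ⁻¹ = proj₁ (inverse _ (λ x≡0 → <-irrefl (sym x≡0) 0<x))

  *-inverseʳ : ∀ {x} (0<x : 0# < x) → x * 0<x ⁻¹ ≡ 1#
  *-inverseʳ 0<x = proj₂ (inverse _ (λ x≡0 → <-irrefl (sym x≡0) 0<x))

  ⁻¹-pos : ∀ {x} (0<x : 0# < x) → 0# < 0<x ⁻¹
  ⁻¹-pos {x} 0<x with compare 0# (0<x ⁻¹)
  ... | tri< pos _ _ = pos
  ... | tri≈ _ 0≡y _ = ⊥-elim (0≢1 (trans (sym (zeroʳ x)) (trans (cong (x *_) 0≡y) (*-inverseʳ 0<x))))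
  ... | tri> _ _ neg = ⊥-elim (<-asym 0<1 (subst₂ _<_ (*-inverseʳ 0<x) (zeroʳ x) (*-monoʳ-<-pos 0<x neg)))

module BigOperators (R : CompleteOrderedField) where
  open OrderedField R public

  ∑ ∏ : (n : ℕ) → (Fin n → Carrier) → Carrier
  ∑ = Defs.∑ R
  ∏ = Defs.∏ R

  infixr 8 _^_
  _^_ : Carrier → ℕ → Carrier
  _^_ = Defs._^_ R

  ∑Fun : (n h : ℕ) → ((Fin n → Fin h) → Carrier) → Carrier
  ∑Fun = Defs.∑Fun R

  ^-homo-* : ∀ x m n → x ^ (m ℕ.+ n) ≡ x ^ m * x ^ n
  ^-homo-* x zero n = sym (*-identityˡ _)
  ^-homo-* x (suc m) n = trans (cong (x *_) (^-homo-* x m n)) (sym (*-assoc x _ _))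

  ^-assocʳ : ∀ x m n → (x ^ m) ^ n ≡ x ^ (m ℕ.* n)
  ^-assocʳ x m zero rewrite ℕₚ.*-zeroʳ m = refl
  ^-assocʳ x m (suc n) rewrite ℕₚ.*-suc m n =
    trans (cong (x ^ m *_) (^-assocʳ x m n)) (sym (^-homo-* x m (m ℕ.* n)))

  ^-distrib-* : ∀ x y n → (x * y) ^ n ≡ x ^ n * y ^ n
  ^-distrib-* x y zero = sym (*-identityˡ 1#)
  ^-distrib-* x y (suc n) =
    trans (cong (x * y *_) (^-distrib-* x y n))
          (solve 4 (λ x y u v → x :* y :* (u :* v) := x :* u :* (y :* v)) refl x y _ _)

  1^n≡1 : ∀ n → 1# ^ n ≡ 1#
  1^n≡1 zero = refl
  1^n≡1 (suc n) = trans (*-identityˡ _) (1^n≡1 n)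

  0^suc≡0 : ∀ n → 0# ^ suc n ≡ 0#
  0^suc≡0 n = zeroˡ _

  ^-nonNeg : ∀ n {x} → 0# ≤ x → 0# ≤ x ^ n
  ^-nonNeg zero 0≤x = 0≤1
  ^-nonNeg (suc n) 0≤x = *-nonNeg 0≤x (^-nonNeg n 0≤x)

  ^-pos : ∀ n {x} → 0# < x → 0# < x ^ n
  ^-pos zero 0<x = 0<1
  ^-pos (suc n) 0<x = *-pos 0<x (^-pos n 0<x)

  ^-monoˡ-≤ : ∀ n {x y} → 0# ≤ x → x ≤ y → x ^ n ≤ y ^ n
  ^-monoˡ-≤ zero 0≤x x≤y = ≤-refl
  ^-monoˡ-≤ (suc n) 0≤x x≤y = *-mono-≤-nonNeg 0≤x (^-nonNeg n 0≤x) x≤y (^-monoˡ-≤ n 0≤x x≤y)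

  ^-monoˡ-< : ∀ n {x y} → 0# ≤ x → x < y → x ^ suc n < y ^ suc n
  ^-monoˡ-< n {x} {y} 0≤x x<y = ≤-<-trans
    (*-monoʳ-≤-nonNeg 0≤x (^-monoˡ-≤ n 0≤x (<⇒≤ x<y)))
    (*-monoˡ-<-pos (^-pos n (≤-<-trans 0≤x x<y)) x<y)

  ^-cancelˡ-≤ : ∀ n {x y} → 0# ≤ y → x ^ suc n ≤ y ^ suc n → x ≤ y
  ^-cancelˡ-≤ n 0≤y xⁿ≤yⁿ = ≮⇒≥ (λ y<x → ≤⇒≯ xⁿ≤yⁿ (^-monoˡ-< n 0≤y y<x))

  ^≡0⇒≡0 : ∀ n {x} → 0# ≤ x → x ^ n ≡ 0# → x ≡ 0#
  ^≡0⇒≡0 n (inj₁ 0<x) xⁿ≡0 = ⊥-elim (<-irrefl (sym xⁿ≡0) (^-pos n 0<x))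
  ^≡0⇒≡0 n (inj₂ 0≡x) _ = sym 0≡x

  ∑-cong : ∀ n {f g} → (∀ i → f i ≡ g i) → ∑ n f ≡ ∑ n g
  ∑-cong zero f≗g = refl
  ∑-cong (suc n) f≗g = cong₂ _+_ (f≗g zero) (∑-cong n (f≗g ∘ suc))

  ∑-zero : ∀ n → ∑ n (λ _ → 0#) ≡ 0#
  ∑-zero zero = refl
  ∑-zero (suc n) = trans (+-identityˡ _) (∑-zero n)

  ∑-distrib-+ : ∀ n f g → ∑ n (λ i → f i + g i) ≡ ∑ n f + ∑ n g
  ∑-distrib-+ zero f g = sym (+-identityˡ 0#)
  ∑-distrib-+ (suc n) f g =
    trans (cong (f zero + g zero +_) (∑-distrib-+ n (f ∘ suc) (g ∘ suc)))
          (solve 4 (λ a b c d → a :+ b :+ (c :+ d) := a :+ c :+ (b :+ d)) refl _ _ _ _)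

  *-distribˡ-∑ : ∀ n c f → c * ∑ n f ≡ ∑ n (λ i → c * f i)
  *-distribˡ-∑ zero c f = zeroʳ c
  *-distribˡ-∑ (suc n) c f = trans (distribˡ c _ _) (cong (c * f zero +_) (*-distribˡ-∑ n c (f ∘ suc)))

  *-distribʳ-∑ : ∀ n c f → ∑ n f * c ≡ ∑ n (λ i → f i * c)
  *-distribʳ-∑ n c f = trans (*-comm _ c) (trans (*-distribˡ-∑ n c f) (∑-cong n (λ i → *-comm c (f i))))

  ∑-comm : ∀ n k (f : Fin n → Fin k → Carrier) →
           ∑ n (λ i → ∑ k (f i)) ≡ ∑ k (λ j → ∑ n (λ i → f i j))
  ∑-comm zero k f = sym (∑-zero k)
  ∑-comm (suc n) k f = trans (cong (∑ k (f zero) +_) (∑-comm n k (f ∘ suc))) (sym (∑-distrib-+ k _ _))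

  ∑-mono-≤ : ∀ n {f g} → (∀ i → f i ≤ g i) → ∑ n f ≤ ∑ n g
  ∑-mono-≤ zero f≤g = ≤-refl
  ∑-mono-≤ (suc n) f≤g = +-mono-≤ (f≤g zero) (∑-mono-≤ n (f≤g ∘ suc))

  ∑-nonNeg : ∀ n {f} → (∀ i → 0# ≤ f i) → 0# ≤ ∑ n f
  ∑-nonNeg n {f} 0≤f = subst (_≤ ∑ n f) (∑-zero n) (∑-mono-≤ n 0≤f)

  term≤∑ : ∀ n {f} → (∀ i → 0# ≤ f i) → ∀ i → f i ≤ ∑ n f
  term≤∑ (suc n) {f} 0≤f zero = x≤x+y (f zero) (∑-nonNeg n (0≤f ∘ suc))
  term≤∑ (suc n) {f} 0≤f (suc i) = ≤-trans (term≤∑ n (0≤f ∘ suc) i) (y≤x+y _ (0≤f zero))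

  ∑-nonNeg-≡0 : ∀ n {f} → (∀ i → 0# ≤ f i) → ∑ n f ≡ 0# → ∀ i → f i ≡ 0#
  ∑-nonNeg-≡0 n 0≤f ∑≡0 i = ≤-antisym (≤-trans (term≤∑ n 0≤f i) (≤-reflexive ∑≡0)) (0≤f i)

  ∏-cong : ∀ n {f g} → (∀ i → f i ≡ g i) → ∏ n f ≡ ∏ n g
  ∏-cong zero f≗g = refl
  ∏-cong (suc n) f≗g = cong₂ _*_ (f≗g zero) (∏-cong n (f≗g ∘ suc))

  ∏-one : ∀ n → ∏ n (λ _ → 1#) ≡ 1#
  ∏-one zero = refl
  ∏-one (suc n) = trans (*-identityˡ _) (∏-one n)

  ∏-const : ∀ n c → ∏ n (λ _ → c) ≡ c ^ n
  ∏-const zero c = refl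
  ∏-const (suc n) c = cong (c *_) (∏-const n c)

  ∏-distrib-* : ∀ n f g → ∏ n (λ i → f i * g i) ≡ ∏ n f * ∏ n g
  ∏-distrib-* zero f g = sym (*-identityˡ 1#)
  ∏-distrib-* (suc n) f g =
    trans (cong (f zero * g zero *_) (∏-distrib-* n (f ∘ suc) (g ∘ suc)))
          (solve 4 (λ a b c d → a :* b :* (c :* d) := a :* c :* (b :* d)) refl _ _ _ _)

  ∏-comm : ∀ n k (f : Fin n → Fin k → Carrier) →
           ∏ n (λ i → ∏ k (f i)) ≡ ∏ k (λ j → ∏ n (λ i → f i j))
  ∏-comm zero k f = sym (∏-one k)
  ∏-comm (suc n) k f = trans (cong (∏ k (f zero) *_) (∏-comm n k (f ∘ suc))) (sym (∏-distrib-* k _ _))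

  ∏-^ : ∀ n f k → ∏ n f ^ k ≡ ∏ n (λ i → f i ^ k)
  ∏-^ n f zero = sym (∏-one n)
  ∏-^ n f (suc k) = trans (cong (∏ n f *_) (∏-^ n f k)) (sym (∏-distrib-* n _ _))

  ∏-nonNeg : ∀ n {f} → (∀ i → 0# ≤ f i) → 0# ≤ ∏ n f
  ∏-nonNeg zero 0≤f = 0≤1
  ∏-nonNeg (suc n) 0≤f = *-nonNeg (0≤f zero) (∏-nonNeg n (0≤f ∘ suc))

  ∏-zero : ∀ n {f} i → f i ≡ 0# → ∏ n f ≡ 0#
  ∏-zero (suc n) {f} zero fi≡0 = trans (cong (_* ∏ n (f ∘ suc)) fi≡0) (zeroˡ _)
  ∏-zero (suc n) {f} (suc i) fi≡0 = trans (cong (f zero *_) (∏-zero n i fi≡0)) (zeroʳ _)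

  -- Defs.∑Fun builds its arguments with a pattern lambda rather than _∷_, so reindexing it needs
  -- integrands that respect pointwise equality.
  Extensional : ∀ {n h} → ((Fin n → Fin h) → Carrier) → Set
  Extensional F = ∀ x y → (∀ o → x o ≡ y o) → F x ≡ F y

  ∑Fun-cong : ∀ n h {F G} → (∀ x → F x ≡ G x) → ∑Fun n h F ≡ ∑Fun n h G
  ∑Fun-cong zero h F≗G = F≗G _
  ∑Fun-cong (suc n) h F≗G = ∑-cong h (λ t → ∑Fun-cong n h (λ x → F≗G _))

  ∑Fun-suc : ∀ n h F → Extensional F → ∑Fun (suc n) h F ≡ ∑ h (λ t → ∑Fun n h (λ x → F (t ∷ x)))
  ∑Fun-suc n h F F-ext = ∑-cong h (λ t → ∑Fun-cong n h (λ x → F-ext _ _ λ { zero → refl ; (suc o) → refl }))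

  *-distribˡ-∑Fun : ∀ n h c F → c * ∑Fun n h F ≡ ∑Fun n h (λ x → c * F x)
  *-distribˡ-∑Fun zero h c F = refl
  *-distribˡ-∑Fun (suc n) h c F = trans (*-distribˡ-∑ h c _) (∑-cong h (λ t → *-distribˡ-∑Fun n h c _))

  ∑Fun-∑ : ∀ n h k (F : Fin k → (Fin n → Fin h) → Carrier) →
           ∑Fun n h (λ x → ∑ k (λ j → F j x)) ≡ ∑ k (λ j → ∑Fun n h (F j))
  ∑Fun-∑ zero h k F = refl
  ∑Fun-∑ (suc n) h k F = trans (∑-cong h (λ t → ∑Fun-∑ n h k _)) (∑-comm h k _)

  ∑Fun-comm : ∀ n m h (F : (Fin n → Fin h) → (Fin m → Fin h) → Carrier) →
              ∑Fun n h (λ x → ∑Fun m h (F x)) ≡ ∑Fun m h (λ y → ∑Fun n h (λ x → F x y))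
  ∑Fun-comm zero m h F = refl
  ∑Fun-comm (suc n) m h F = trans (∑-cong h (λ t → ∑Fun-comm n m h _)) (sym (∑Fun-∑ m h h _))

  ∑Fun-mono-≤ : ∀ n h {F G} → (∀ x → F x ≤ G x) → ∑Fun n h F ≤ ∑Fun n h G
  ∑Fun-mono-≤ zero h F≤G = F≤G _
  ∑Fun-mono-≤ (suc n) h F≤G = ∑-mono-≤ h (λ t → ∑Fun-mono-≤ n h (λ x → F≤G _))

  ∑Fun-nonNeg : ∀ n h {F} → (∀ x → 0# ≤ F x) → 0# ≤ ∑Fun n h F
  ∑Fun-nonNeg zero h 0≤F = 0≤F _
  ∑Fun-nonNeg (suc n) h 0≤F = ∑-nonNeg h (λ t → ∑Fun-nonNeg n h (λ x → 0≤F _))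

  ∑Fun-∏ : ∀ n h (φ : Fin n → Fin h → Carrier) →
           ∑Fun n h (λ x → ∏ n (λ o → φ o (x o))) ≡ ∏ n (λ o → ∑ h (φ o))
  ∑Fun-∏ zero h φ = refl
  ∑Fun-∏ (suc n) h φ = begin
    ∑ h (λ t → ∑Fun n h (λ x → φ zero t * ∏ n (λ o → φ (suc o) (x o))))
      ≡⟨ ∑-cong h (λ t → sym (*-distribˡ-∑Fun n h (φ zero t) _)) ⟩
    ∑ h (λ t → φ zero t * ∑Fun n h (λ x → ∏ n (λ o → φ (suc o) (x o))))
      ≡⟨ ∑-cong h (λ t → cong (φ zero t *_) (∑Fun-∏ n h (φ ∘ suc))) ⟩
    ∑ h (λ t → φ zero t * ∏ n (λ o → ∑ h (φ (suc o))))
      ≡⟨ sym (*-distribʳ-∑ h _ (φ zero)) ⟩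
    ∑ h (φ zero) * ∏ n (λ o → ∑ h (φ (suc o))) ∎
    where open ≡-Reasoning

  ∑-^ : ∀ b h f → ∑ h f ^ b ≡ ∑Fun b h (λ v → ∏ b (λ c → f (v c)))
  ∑-^ b h f = trans (sym (∏-const b (∑ h f))) (sym (∑Fun-∏ b h (λ _ → f)))

  ∏ₛ ∑ₛ : (K : ℕ) → (Fin K → Bool) → (Fin K → Carrier) → Carrier
  ∏ₛ K S f = ∏ K (λ k → if S k then f k else 1#)
  ∑ₛ K S f = ∑ K (λ k → if S k then f k else 0#)

  if-cong : ∀ b {x y z : Carrier} → (b ≡ true → x ≡ y) → (if b then x else z) ≡ (if b then y else z)
  if-cong true x≡y = x≡y refl
  if-cong false x≡y = refl

  if-nonNeg : ∀ b {x y} → 0# ≤ x → 0# ≤ y → 0# ≤ (if b then x else y)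
  if-nonNeg true 0≤x 0≤y = 0≤x
  if-nonNeg false 0≤x 0≤y = 0≤y

  ∏ₛ-cong : ∀ K S {f g} → (∀ k → S k ≡ true → f k ≡ g k) → ∏ₛ K S f ≡ ∏ₛ K S g
  ∏ₛ-cong K S f≗g = ∏-cong K (λ k → if-cong (S k) (f≗g k))

  ∑ₛ-cong : ∀ K S {f g} → (∀ k → S k ≡ true → f k ≡ g k) → ∑ₛ K S f ≡ ∑ₛ K S g
  ∑ₛ-cong K S f≗g = ∑-cong K (λ k → if-cong (S k) (f≗g k))

  ∏ₛ-nonNeg : ∀ K S {f} → (∀ k → 0# ≤ f k) → 0# ≤ ∏ₛ K S f
  ∏ₛ-nonNeg K S 0≤f = ∏-nonNeg K (λ k → if-nonNeg (S k) (0≤f k) 0≤1)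

  ∑ₛ-nonNeg : ∀ K S {f} → (∀ k → 0# ≤ f k) → 0# ≤ ∑ₛ K S f
  ∑ₛ-nonNeg K S 0≤f = ∑-nonNeg K (λ k → if-nonNeg (S k) (0≤f k) ≤-refl)

  ∏ₛ-distrib-* : ∀ K S f g → ∏ₛ K S (λ k → f k * g k) ≡ ∏ₛ K S f * ∏ₛ K S g
  ∏ₛ-distrib-* K S f g = trans (∏-cong K (λ k → split (S k))) (∏-distrib-* K _ _)
    where
    split : ∀ b {x y} → (if b then x * y else 1#) ≡ (if b then x else 1#) * (if b then y else 1#)
    split true = refl
    split false = sym (*-identityˡ 1#)

  ∏ₛ-^ : ∀ K S f n → ∏ₛ K S f ^ n ≡ ∏ₛ K S (λ k → f k ^ n)
  ∏ₛ-^ K S f n = trans (∏-^ K _ n) (∏-cong K (λ k → power (S k)))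
    where
    power : ∀ b {x} → (if b then x else 1#) ^ n ≡ (if b then x ^ n else 1#)
    power true = refl
    power false = 1^n≡1 n

  ∏ₛ-const : ∀ K S c → ∏ₛ K S (λ _ → c) ≡ c ^ countB K S
  ∏ₛ-const zero S c = refl
  ∏ₛ-const (suc K) S c with S zero
  ... | true = cong (c *_) (∏ₛ-const K (S ∘ suc) c)
  ... | false = trans (*-identityˡ _) (∏ₛ-const K (S ∘ suc) c)

  ∑ₛ-one : ∀ K S → ∑ₛ K S (λ _ → 1#) ≡ fromℕ (countB K S)
  ∑ₛ-one zero S = refl
  ∑ₛ-one (suc K) S with S zero
  ... | true = cong (1# +_) (∑ₛ-one K (S ∘ suc))
  ... | false = trans (+-identityˡ _) (∑ₛ-one K (S ∘ suc))

  ∏-∏ₛ-split : ∀ K S f → ∏ K f ≡ ∏ₛ K S f * ∏ₛ K (not ∘ S) f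
  ∏-∏ₛ-split K S f = trans (∏-cong K (λ k → split (S k))) (∏-distrib-* K _ _)
    where
    split : ∀ b {x} → x ≡ (if b then x else 1#) * (if not b then x else 1#)
    split true = sym (*-identityʳ _)
    split false = sym (*-identityˡ _)

  ∑-∑ₛ-comm : ∀ h K S (f : Fin h → Fin K → Carrier) →
              ∑ h (λ t → ∑ₛ K S (f t)) ≡ ∑ₛ K S (λ k → ∑ h (λ t → f t k))
  ∑-∑ₛ-comm h K S f = trans (∑-comm h K _) (∑-cong K (λ k → pull (S k)))
    where
    pull : ∀ b {k} → ∑ h (λ t → if b then f t k else 0#) ≡ (if b then ∑ h (λ t → f t k) else 0#)
    pull true = refl
    pull false = ∑-zero h

  *-distribˡ-∑ₛ : ∀ K S c f → c * ∑ₛ K S f ≡ ∑ₛ K S (λ k → c * f k)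
  *-distribˡ-∑ₛ K S c f = trans (*-distribˡ-∑ K c _) (∑-cong K (λ k → pull (S k)))
    where
    pull : ∀ b {k} → c * (if b then f k else 0#) ≡ (if b then c * f k else 0#)
    pull true = refl
    pull false = zeroʳ c

  ∏-∏ₛ-comm : ∀ b n S (f : Fin b → Fin n → Carrier) →
              ∏ b (λ c → ∏ₛ n S (f c)) ≡ ∏ₛ n S (λ o → ∏ b (λ c → f c o))
  ∏-∏ₛ-comm b n S f = trans (∏-comm b n _) (∏-cong n (λ o → pull (S o)))
    where
    pull : ∀ s {o} → ∏ b (λ c → if s then f c o else 1#) ≡ (if s then ∏ b (λ c → f c o) else 1#)
    pull true = refl
    pull false = ∏-one b

  -- Multiplied through by y ^ countB n S to avoid the truncated subtraction n ∸ countB n S.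
  ∏-if-const : ∀ n S x y → ∏ n (λ o → if S o then x else y) * y ^ countB n S ≡ x ^ countB n S * y ^ n
  ∏-if-const zero S x y = refl
  ∏-if-const (suc n) S x y with S zero
  ... | true = begin
    x * P * (y * y ^ c)
      ≡⟨ solve 4 (λ x P y yᶜ → x :* P :* (y :* yᶜ) := x :* y :* (P :* yᶜ)) refl x P y (y ^ c) ⟩
    x * y * (P * y ^ c)
      ≡⟨ cong (x * y *_) (∏-if-const n (S ∘ suc) x y) ⟩
    x * y * (x ^ c * y ^ n)
      ≡⟨ solve 4 (λ x y xᶜ yⁿ → x :* y :* (xᶜ :* yⁿ) := x :* xᶜ :* (y :* yⁿ)) refl x y (x ^ c) (y ^ n) ⟩
    x * x ^ c * (y * y ^ n) ∎
    where
    open ≡-Reasoning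
    P = ∏ n (λ o → if S (suc o) then x else y)
    c = countB n (S ∘ suc)
  ... | false = begin
    y * P * y ^ c
      ≡⟨ *-assoc y P (y ^ c) ⟩
    y * (P * y ^ c)
      ≡⟨ cong (y *_) (∏-if-const n (S ∘ suc) x y) ⟩
    y * (x ^ c * y ^ n)
      ≡⟨ solve 3 (λ y xᶜ yⁿ → y :* (xᶜ :* yⁿ) := xᶜ :* (y :* yⁿ)) refl y (x ^ c) (y ^ n) ⟩
    x ^ c * (y * y ^ n) ∎
    where
    open ≡-Reasoning
    P = ∏ n (λ o → if S (suc o) then x else y)
    c = countB n (S ∘ suc)

module AMGM (R : CompleteOrderedField) where
  open BigOperators R public

  fromℕ-nonNeg : ∀ n → 0# ≤ fromℕ n
  fromℕ-nonNeg zero = ≤-refl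
  fromℕ-nonNeg (suc n) = +-nonNeg 0≤1 (fromℕ-nonNeg n)

  fromℕ-pos : ∀ n → 0# < fromℕ (suc n)
  fromℕ-pos n = subst (_< fromℕ (suc n)) (+-identityʳ 0#) (+-mono-<-≤ 0<1 (fromℕ-nonNeg n))

  2xy≤x²+y² : ∀ x y → y * x + y * x ≤ x * x + y * y
  2xy≤x²+y² x y = subst₂ _≤_ (+-identityˡ _) expand (+-monoˡ-≤ (y * x + y * x) (square-nonNeg (x + - y)))
    where
    expand : (x + - y) * (x + - y) + (y * x + y * x) ≡ x * x + y * y
    expand = begin
      (x + - y) * (x + - y) + (y * x + y * x)
        ≡⟨ solve 3 (λ x y z → (x :+ z) :* (x :+ z) :+ (y :* x :+ y :* x)
                             := x :* x :+ z :* z :+ (x :* (z :+ y) :+ x :* (z :+ y))) refl x y (- y) ⟩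
      x * x + - y * - y + (x * (- y + y) + x * (- y + y))
        ≡⟨ cong₂ (λ u v → x * x + u + (x * v + x * v)) (-x*-x≡x*x y) (-‿inverseˡ y) ⟩
      x * x + y * y + (x * 0# + x * 0#)
        ≡⟨ solve 2 (λ x y → x :* x :+ y :* y :+ (x :* con 0 :+ x :* con 0) := x :* x :+ y :* y) refl x y ⟩
      x * x + y * y ∎
      where open ≡-Reasoning

  ^-above-tangent : ∀ k {x y} → 0# ≤ x → 0# ≤ y →
                    fromℕ (suc k) * y ^ k * x ≤ x ^ suc k + fromℕ k * y ^ suc k
  ^-above-tangent zero {x} {y} _ _ =
    ≤-reflexive (solve 2 (λ x y → (con 1 :+ con 0) :* con 1 :* x := x :* con 1 :+ con 0 :* (y :* con 1)) refl x y)
  ^-above-tangent (suc k) {x} {y} 0≤x 0≤y = +-cancelʳ-≤ T (begin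
    (1# + (1# + n)) * (y * p) * x + T
      ≡⟨ solve 4 (λ n p x y → (con 1 :+ (con 1 :+ n)) :* (y :* p) :* x
                                :+ ((con 1 :+ n) :* p :* x :* x :+ n :* (y :* p) :* x)
                           := (con 1 :+ n) :* p :* x :* x :+ (con 1 :+ n) :* p :* (y :* x :+ y :* x))
                 refl n p x y ⟩
    (1# + n) * p * x * x + (1# + n) * p * (y * x + y * x)
      ≤⟨ +-mono-≤ (*-monoˡ-≤-nonNeg 0≤x (^-above-tangent k 0≤x 0≤y))
                  (*-monoʳ-≤-nonNeg (*-nonNeg (fromℕ-nonNeg (suc k)) (^-nonNeg k 0≤y)) (2xy≤x²+y² x y)) ⟩
    (x * q + n * (y * p)) * x + (1# + n) * p * (x * x + y * y)
      ≡⟨ solve 5 (λ n p q x y → (x :* q :+ n :* (y :* p)) :* x :+ (con 1 :+ n) :* p :* (x :* x :+ y :* y)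
                             := x :* (x :* q) :+ (con 1 :+ n) :* (y :* (y :* p))
                                :+ ((con 1 :+ n) :* p :* x :* x :+ n :* (y :* p) :* x))
                 refl n p q x y ⟩
    x * (x * q) + (1# + n) * (y * (y * p)) + T ∎)
    where
    open ≤-Reasoning
    n = fromℕ k
    p = y ^ k
    q = x ^ k
    T = (1# + n) * p * x * x + n * (y * p) * x

  -- ^-above-tangent at x = c (s + w) and y = (c + 1) s.
  amgm-step : ∀ c {s w} → 0# ≤ s → 0# ≤ w →
              fromℕ c * fromℕ (suc c) ^ suc c * (s ^ c * w) ≤ fromℕ c ^ suc c * (s + w) ^ suc c
  amgm-step c {s} {w} 0≤s 0≤w = +-cancelʳ-≤ T (begin
    N * N₁ ^ suc c * (s ^ c * w) + T
      ≡⟨ solve 6 (λ N N₁ P Q s w → N :* (N₁ :* P) :* (Q :* w) :+ N :* (N₁ :* P) :* (Q :* s)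
                                := N₁ :* (P :* Q) :* (N :* (s :+ w))) refl N N₁ (N₁ ^ c) (s ^ c) s w ⟩
    N₁ * (N₁ ^ c * s ^ c) * (N * (s + w))
      ≡⟨ cong (λ z → N₁ * z * (N * (s + w))) (sym (^-distrib-* N₁ s c)) ⟩
    N₁ * (N₁ * s) ^ c * (N * (s + w))
      ≤⟨ ^-above-tangent c (*-nonNeg (fromℕ-nonNeg c) (+-nonNeg 0≤s 0≤w)) (*-nonNeg (fromℕ-nonNeg (suc c)) 0≤s) ⟩
    (N * (s + w)) ^ suc c + N * (N₁ * s) ^ suc c
      ≡⟨ cong₂ (λ u v → u + N * v) (^-distrib-* N (s + w) (suc c)) (^-distrib-* N₁ s (suc c)) ⟩
    N ^ suc c * (s + w) ^ suc c + N * (N₁ ^ suc c * s ^ suc c)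
      ≡⟨ cong (N ^ suc c * (s + w) ^ suc c +_)
              (solve 5 (λ N N₁ P Q s → N :* (N₁ :* P :* (s :* Q)) := N :* (N₁ :* P) :* (Q :* s))
                       refl N N₁ (N₁ ^ c) (s ^ c) s) ⟩
    N ^ suc c * (s + w) ^ suc c + T ∎)
    where
    open ≤-Reasoning
    N = fromℕ c
    N₁ = fromℕ (suc c)
    T = N * N₁ ^ suc c * (s ^ c * s)

  countB≡0⇒false : ∀ K S → countB K S ≡ 0 → ∀ k → S k ≡ false
  countB≡0⇒false (suc K) S count≡0 k with S zero in S₀
  countB≡0⇒false (suc K) S count≡0 zero | false = S₀
  countB≡0⇒false (suc K) S count≡0 (suc k) | false = countB≡0⇒false K (λ i → S (suc i)) count≡0 k
  countB≡0⇒false (suc K) S () k | true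

  ∏ₛ-none : ∀ K S f → countB K S ≡ 0 → ∏ₛ K S f ≡ 1#
  ∏ₛ-none K S f count≡0 =
    trans (∏-cong K (λ k → cong (λ b → if b then f k else 1#) (countB≡0⇒false K S count≡0 k))) (∏-one K)

  ∑ₛ-none : ∀ K S f → countB K S ≡ 0 → ∑ₛ K S f ≡ 0#
  ∑ₛ-none K S f count≡0 =
    trans (∑-cong K (λ k → cong (λ b → if b then f k else 0#) (countB≡0⇒false K S count≡0 k))) (∑-zero K)

  -- A new selected term w₀ is added to the others by amgm-step, with s the sum of the others.
  amgm-^ : ∀ K S {w} → (∀ k → 0# ≤ w k) →
           fromℕ (countB K S) ^ countB K S * ∏ₛ K S w ≤ ∑ₛ K S w ^ countB K S
  amgm-^ zero S 0≤w = ≤-reflexive (*-identityˡ 1#)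
  amgm-^ (suc K) S {w} 0≤w with S zero
  ... | false = subst₂ (λ u v → fromℕ c ^ c * u ≤ v ^ c) (sym (*-identityˡ _)) (sym (+-identityˡ _))
                       (amgm-^ K (λ i → S (suc i)) (0≤w ∘ suc))
    where c = countB K (λ i → S (suc i))
  ... | true with countB K (λ i → S (suc i)) in count | amgm-^ K (λ i → S (suc i)) (0≤w ∘ suc)
  ...   | zero | _ rewrite ∏ₛ-none K (λ i → S (suc i)) (w ∘ suc) count
                        | ∑ₛ-none K (λ i → S (suc i)) (w ∘ suc) count =
    ≤-reflexive (solve 1 (λ w → (con 1 :+ con 0) :* con 1 :* (w :* con 1) := (w :+ con 0) :* con 1) refl (w zero))
  ...   | suc c | ih = *-cancelˡ-≤-pos (^-pos (suc (suc c)) (fromℕ-pos c)) (begin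
    N ^ suc (suc c) * (A * (w₀ * P))
      ≡⟨ solve 5 (λ N Nᶜ A w₀ P → N :* Nᶜ :* (A :* (w₀ :* P)) := N :* A :* w₀ :* (Nᶜ :* P))
                 refl N (N ^ suc c) A w₀ P ⟩
    N * A * w₀ * (N ^ suc c * P)
      ≤⟨ *-monoʳ-≤-nonNeg (*-nonNeg (*-nonNeg (fromℕ-nonNeg (suc c))
                                              (^-nonNeg (suc (suc c)) (fromℕ-nonNeg (suc (suc c)))))
                                    (0≤w zero)) ih ⟩
    N * A * w₀ * U ^ suc c
      ≡⟨ solve 4 (λ N A w₀ Uᶜ → N :* A :* w₀ :* Uᶜ := N :* A :* (Uᶜ :* w₀)) refl N A w₀ (U ^ suc c) ⟩
    N * A * (U ^ suc c * w₀)
      ≤⟨ amgm-step (suc c) (∑ₛ-nonNeg K _ (0≤w ∘ suc)) (0≤w zero) ⟩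
    N ^ suc (suc c) * (U + w₀) ^ suc (suc c)
      ≡⟨ cong (λ z → N ^ suc (suc c) * z ^ suc (suc c)) (+-comm U w₀) ⟩
    N ^ suc (suc c) * (w₀ + U) ^ suc (suc c) ∎)
    where
    open ≤-Reasoning
    N = fromℕ (suc c)
    A = fromℕ (suc (suc c)) ^ suc (suc c)
    w₀ = w zero
    P = ∏ₛ K (λ i → S (suc i)) (w ∘ suc)
    U = ∑ₛ K (λ i → S (suc i)) (w ∘ suc)

  amgm : ∀ K S {v} → (∀ k → 0# ≤ v k) →
         fromℕ (countB K S) * ∏ₛ K S v ≤ ∑ₛ K S (λ k → v k ^ countB K S)
  amgm K S {v} 0≤v
    with countB K S | amgm-^ K S {λ k → v k ^ countB K S} (λ k → ^-nonNeg (countB K S) (0≤v k))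
  ... | zero | _ = subst (_≤ ∑ₛ K S (λ k → v k ^ 0)) (sym (zeroˡ (∏ₛ K S v))) (∑ₛ-nonNeg K S (λ k → 0≤1))
  ... | suc c | amgm-^-powers = ^-cancelˡ-≤ c (∑ₛ-nonNeg K S (λ k → ^-nonNeg (suc c) (0≤v k))) (begin
    (fromℕ (suc c) * ∏ₛ K S v) ^ suc c
      ≡⟨ ^-distrib-* (fromℕ (suc c)) _ (suc c) ⟩
    fromℕ (suc c) ^ suc c * ∏ₛ K S v ^ suc c
      ≡⟨ cong (fromℕ (suc c) ^ suc c *_) (∏ₛ-^ K S v (suc c)) ⟩
    fromℕ (suc c) ^ suc c * ∏ₛ K S (λ k → v k ^ suc c)
      ≤⟨ amgm-^-powers ⟩
    ∑ₛ K S (λ k → v k ^ suc c) ^ suc c ∎)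
    where open ≤-Reasoning

module Roots (R : CompleteOrderedField) where
  open AMGM R public

  ≤⇒0≤- : ∀ {x y} → x ≤ y → 0# ≤ y + - x
  ≤⇒0≤- {x} x≤y = subst (_≤ _) (-‿inverseʳ x) (+-monoˡ-≤ (- x) x≤y)

  x≤x^suc : ∀ n {x} → 1# ≤ x → x ≤ x ^ suc n
  x≤x^suc n {x} 1≤x = subst (_≤ x ^ suc n) (*-identityʳ x)
    (*-monoʳ-≤-nonNeg (≤-trans 0≤1 1≤x) (subst (_≤ x ^ n) (1^n≡1 n) (^-monoˡ-≤ n 0≤1 1≤x)))

  ^-mean-value : ∀ n {y d} → 0# ≤ y → 0# ≤ d →
                 (y + d) ^ suc n ≤ y ^ suc n + d * (fromℕ (suc n) * (y + d) ^ n)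
  ^-mean-value zero {y} {d} _ _ =
    ≤-reflexive (solve 2 (λ y d → (y :+ d) :* con 1 := y :* con 1 :+ d :* ((con 1 :+ con 0) :* con 1)) refl y d)
  ^-mean-value (suc n) {y} {d} 0≤y 0≤d = begin
    (y + d) * (y + d) ^ suc n
      ≤⟨ *-monoʳ-≤-nonNeg (+-nonNeg 0≤y 0≤d) (^-mean-value n 0≤y 0≤d) ⟩
    (y + d) * (y ^ suc n + d * (N * (y + d) ^ n))
      ≡⟨ solve 5 (λ y d P N X → (y :+ d) :* (P :+ d :* (N :* X)) := y :* P :+ d :* (P :+ N :* ((y :+ d) :* X)))
               refl y d (y ^ suc n) N ((y + d) ^ n) ⟩
    y * y ^ suc n + d * (y ^ suc n + N * (y + d) ^ suc n)
      ≤⟨ +-monoʳ-≤ (y * y ^ suc n) (*-monoʳ-≤-nonNeg 0≤d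
           (+-monoˡ-≤ (N * (y + d) ^ suc n) (^-monoˡ-≤ (suc n) 0≤y (x≤x+y y 0≤d)))) ⟩
    y * y ^ suc n + d * ((y + d) ^ suc n + N * (y + d) ^ suc n)
      ≡⟨ cong (λ z → y * y ^ suc n + d * z) (trans (cong (_+ N * (y + d) ^ suc n) (sym (*-identityˡ _)))
                                                 (sym (distribʳ ((y + d) ^ suc n) 1# N))) ⟩
    y * y ^ suc n + d * ((1# + N) * (y + d) ^ suc n) ∎
    where
    open ≤-Reasoning
    N = fromℕ (suc n)

  small-pos : ∀ {δ t M} → 0# < δ → 0# < t → 0# ≤ M → Σ Carrier λ ε → 0# < ε × ε ≤ t × ε * M < δ
  small-pos {δ} {t} {M} 0<δ 0<t 0≤M = ε , 0<ε , ε≤t , εM<δ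
    where
    0<D : 0# < M * t + δ
    0<D = ≤-<-trans (*-nonNeg 0≤M (<⇒≤ 0<t)) (x<x+y (M * t) 0<δ)
    D = M * t + δ
    ε = δ * t * 0<D ⁻¹
    0<ε : 0# < ε
    0<ε = *-pos (*-pos 0<δ 0<t) (⁻¹-pos 0<D)
    εD≡δt : ε * D ≡ δ * t
    εD≡δt = trans (*-assoc (δ * t) _ D)
                  (trans (cong (δ * t *_) (trans (*-comm _ D) (*-inverseʳ 0<D))) (*-identityʳ _))
    ε≤t : ε ≤ t
    ε≤t = *-cancelʳ-≤-pos 0<D (begin
      ε * D    ≡⟨ trans εD≡δt (*-comm δ t) ⟩
      t * δ    ≤⟨ *-monoʳ-≤-nonNeg (<⇒≤ 0<t) (y≤x+y δ (*-nonNeg 0≤M (<⇒≤ 0<t))) ⟩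
      t * D    ∎)
      where open ≤-Reasoning
    εM<δ : ε * M < δ
    εM<δ = *-cancelʳ-<-pos 0<t (begin-strict
      ε * M * t            ≡⟨ sym (+-identityʳ _) ⟩
      ε * M * t + 0#       <⟨ +-monoʳ-< (ε * M * t) (*-pos 0<ε 0<δ) ⟩
      ε * M * t + ε * δ    ≡⟨ solve 4 (λ ε M t δ → ε :* M :* t :+ ε :* δ := ε :* (M :* t :+ δ)) refl ε M t δ ⟩
      ε * D                ≡⟨ εD≡δt ⟩
      δ * t                ∎)
      where open ≤-Reasoning

  x+[y-x]≡y : ∀ x y → x + (y + - x) ≡ y
  x+[y-x]≡y x y = trans (+-comm x _) (x-y+y≡x y x)

  RootBelow : ℕ → Carrier → Carrier → Set
  RootBelow n c x = 0# ≤ x × x ^ suc n ≤ c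

  RootBelow-bounded : ∀ n {c} → 0# < c → ∀ x → RootBelow n c x → x ≤ 1# + c
  RootBelow-bounded n {c} 0<c x (_ , xᵇ≤c) = ≮⇒≥ λ 1+c<x → <-irrefl refl (begin-strict
    x          ≤⟨ x≤x^suc n (<⇒≤ (≤-<-trans (x≤x+y 1# (<⇒≤ 0<c)) 1+c<x)) ⟩
    x ^ suc n  ≤⟨ xᵇ≤c ⟩
    c          <⟨ subst (_< 1# + c) (+-identityˡ c) (+-mono-< c 0<1) ⟩
    1# + c     <⟨ 1+c<x ⟩
    x          ∎)
    where open ≤-Reasoning

  sup-not-below : ∀ n {c s} → 0# ≤ s → (∀ x → RootBelow n c x → x ≤ s) → ¬ (s ^ suc n < c)
  sup-not-below n {c} {s} 0≤s upper sᵇ<c =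
    step-above (small-pos (<⇒0<- sᵇ<c) 0<1 (*-nonNeg 0≤N (^-nonNeg n (+-nonNeg 0≤s 0≤1))))
    where
    N = fromℕ (suc n)
    0≤N = fromℕ-nonNeg (suc n)
    step-above : (Σ Carrier λ ε → 0# < ε × ε ≤ 1# × ε * (N * (s + 1#) ^ n) < c + - (s ^ suc n)) → ⊥
    step-above (ε , 0<ε , ε≤1 , εM<δ) =
      <-irrefl refl (<-≤-trans (x<x+y s 0<ε) (upper (s + ε) (0≤s+ε , <⇒≤ s+ε-below)))
      where
      open ≤-Reasoning
      0≤s+ε = +-nonNeg 0≤s (<⇒≤ 0<ε)
      s+ε-below : (s + ε) ^ suc n < c
      s+ε-below = begin-strict
        (s + ε) ^ suc n                        ≤⟨ ^-mean-value n 0≤s (<⇒≤ 0<ε) ⟩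
        s ^ suc n + ε * (N * (s + ε) ^ n)      ≤⟨ +-monoʳ-≤ (s ^ suc n) (*-monoʳ-≤-nonNeg (<⇒≤ 0<ε)
                                                    (*-monoʳ-≤-nonNeg 0≤N (^-monoˡ-≤ n 0≤s+ε (+-monoʳ-≤ s ε≤1)))) ⟩
        s ^ suc n + ε * (N * (s + 1#) ^ n)     <⟨ +-monoʳ-< (s ^ suc n) εM<δ ⟩
        s ^ suc n + (c + - (s ^ suc n))        ≡⟨ x+[y-x]≡y (s ^ suc n) c ⟩
        c                                      ∎

  sup-not-above : ∀ n {c s} → 0# < c → 0# ≤ s →
                  (∀ u → (∀ x → RootBelow n c x → x ≤ u) → s ≤ u) → ¬ (c < s ^ suc n)
  sup-not-above n {c} {s} 0<c (inj₂ 0≡s) least c<sᵇ =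
    <-asym 0<c (subst (c <_) (trans (cong (_^ suc n) (sym 0≡s)) (0^suc≡0 n)) c<sᵇ)
  sup-not-above n {c} {s} 0<c (inj₁ 0<s) least c<sᵇ =
    step-below (small-pos (<⇒0<- c<sᵇ) 0<s (*-nonNeg 0≤N (^-nonNeg n (<⇒≤ 0<s))))
    where
    N = fromℕ (suc n)
    0≤N = fromℕ-nonNeg (suc n)
    step-below : (Σ Carrier λ ε → 0# < ε × ε ≤ s × ε * (N * s ^ n) < s ^ suc n + - c) → ⊥
    step-below (ε , 0<ε , ε≤s , εM<δ) = <-irrefl refl (<-≤-trans y<s (least y y-upper))
      where
      open ≤-Reasoning
      y = s + - ε
      y+ε≡s : y + ε ≡ s
      y+ε≡s = x-y+y≡x s ε
      0≤y = ≤⇒0≤- ε≤s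
      y<s : y < s
      y<s = subst (y <_) y+ε≡s (x<x+y y 0<ε)
      c<yᵇ : c < y ^ suc n
      c<yᵇ = +-cancelʳ-< (s ^ suc n + - c) (begin-strict
        c + (s ^ suc n + - c)                  ≡⟨ x+[y-x]≡y c (s ^ suc n) ⟩
        s ^ suc n                              ≡⟨ cong (_^ suc n) (sym y+ε≡s) ⟩
        (y + ε) ^ suc n                        ≤⟨ ^-mean-value n 0≤y (<⇒≤ 0<ε) ⟩
        y ^ suc n + ε * (N * (y + ε) ^ n)      ≡⟨ cong (λ z → y ^ suc n + ε * (N * z ^ n)) y+ε≡s ⟩
        y ^ suc n + ε * (N * s ^ n)            <⟨ +-monoʳ-< (y ^ suc n) εM<δ ⟩
        y ^ suc n + (s ^ suc n + - c)          ∎)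
      y-upper : ∀ x → RootBelow n c x → x ≤ y
      y-upper x (_ , xᵇ≤c) = ≮⇒≥ λ y<x → <-irrefl refl (begin-strict
        c          <⟨ c<yᵇ ⟩
        y ^ suc n  <⟨ ^-monoˡ-< n 0≤y y<x ⟩
        x ^ suc n  ≤⟨ xᵇ≤c ⟩
        c          ∎)

  RootBelow-0 : ∀ n {c} → 0# < c → RootBelow n c 0#
  RootBelow-0 n {c} 0<c = ≤-refl , subst (_≤ c) (sym (0^suc≡0 n)) (<⇒≤ 0<c)

  root-exists : ∀ n {c} → 0# < c → Σ Carrier λ r → 0# ≤ r × r ^ suc n ≡ c
  root-exists n {c} 0<c with supremum (RootBelow n c) (0# , RootBelow-0 n 0<c) (1# + c , RootBelow-bounded n 0<c)
  ... | s , upper , least with compare (s ^ suc n) c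
  ...   | tri< sᵇ<c _ _ = ⊥-elim (sup-not-below n (upper 0# (RootBelow-0 n 0<c)) upper sᵇ<c)
  ...   | tri≈ _ sᵇ≡c _ = s , upper 0# (RootBelow-0 n 0<c) , sᵇ≡c
  ...   | tri> _ _ c<sᵇ = ⊥-elim (sup-not-above n 0<c (upper 0# (RootBelow-0 n 0<c)) least c<sᵇ)

  -- The (n+1)-th root; the junk value 0# is returned for negative arguments.
  root : ℕ → Carrier → Carrier
  root n c with compare 0# c
  ... | tri< 0<c _ _ = proj₁ (root-exists n 0<c)
  ... | tri≈ _ _ _ = 0#
  ... | tri> _ _ _ = 0#

  root-nonNeg : ∀ n c → 0# ≤ root n c
  root-nonNeg n c with compare 0# c
  ... | tri< 0<c _ _ = proj₁ (proj₂ (root-exists n 0<c))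
  ... | tri≈ _ _ _ = ≤-refl
  ... | tri> _ _ _ = ≤-refl

  root-^ : ∀ n {c} → 0# ≤ c → root n c ^ suc n ≡ c
  root-^ n {c} 0≤c with compare 0# c
  ... | tri< 0<c _ _ = proj₂ (proj₂ (root-exists n 0<c))
  ... | tri≈ _ 0≡c _ = trans (0^suc≡0 n) 0≡c
  ... | tri> _ _ c<0 = ⊥-elim (≤⇒≯ 0≤c c<0)

module Hölder (R : CompleteOrderedField) where
  open Roots R public

  hölder-unit-norms : ∀ {h} (μ : Fin h → Carrier) b K S (v : Fin h → Fin K → Carrier) →
    countB K S ≡ suc b → (∀ t → 0# ≤ μ t) → (∀ t k → 0# ≤ v t k) →
    (∀ k → S k ≡ true → ∑ h (λ t → μ t * v t k ^ suc b) ≡ 1#) →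
    ∑ h (λ t → μ t * ∏ₛ K S (v t)) ≤ 1#
  hölder-unit-norms {h} μ b K S v count 0≤μ 0≤v unit = *-cancelˡ-≤-pos (fromℕ-pos b) (begin
    B * ∑ h (λ t → μ t * ∏ₛ K S (v t))
      ≡⟨ trans (*-distribˡ-∑ h B _)
               (∑-cong h (λ t → solve 3 (λ B m P → B :* (m :* P) := m :* (B :* P)) refl B (μ t) _)) ⟩
    ∑ h (λ t → μ t * (B * ∏ₛ K S (v t)))
      ≤⟨ ∑-mono-≤ h (λ t → *-monoʳ-≤-nonNeg (0≤μ t) (amgm-at t)) ⟩
    ∑ h (λ t → μ t * ∑ₛ K S (λ k → v t k ^ suc b))
      ≡⟨ ∑-cong h (λ t → *-distribˡ-∑ₛ K S (μ t) _) ⟩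
    ∑ h (λ t → ∑ₛ K S (λ k → μ t * v t k ^ suc b))
      ≡⟨ ∑-∑ₛ-comm h K S _ ⟩
    ∑ₛ K S (λ k → ∑ h (λ t → μ t * v t k ^ suc b))
      ≡⟨ ∑ₛ-cong K S unit ⟩
    ∑ₛ K S (λ _ → 1#)
      ≡⟨ trans (∑ₛ-one K S) (trans (cong fromℕ count) (sym (*-identityʳ B))) ⟩
    B * 1# ∎)
    where
    open ≤-Reasoning
    B = fromℕ (suc b)
    amgm-at : ∀ t → B * ∏ₛ K S (v t) ≤ ∑ₛ K S (λ k → v t k ^ suc b)
    amgm-at t = subst (λ n → fromℕ n * ∏ₛ K S (v t) ≤ ∑ₛ K S (λ k → v t k ^ n)) count (amgm K S (0≤v t))

  hölder-pos-norms : ∀ {h} (μ : Fin h → Carrier) b K S (u : Fin K → Fin h → Carrier) (r : Fin K → Carrier) →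
    countB K S ≡ suc b → (∀ t → 0# ≤ μ t) → (∀ k t → 0# ≤ u k t) → (0<r : ∀ k → 0# < r k) →
    (∀ k → S k ≡ true → ∑ h (λ t → μ t * u k t ^ suc b) ≡ r k ^ suc b) →
    ∑ h (λ t → μ t * ∏ₛ K S (λ k → u k t)) ≤ ∏ₛ K S r
  hölder-pos-norms {h} μ b K S u r count 0≤μ 0≤u 0<r norm≡rᵇ = begin
    L
      ≡⟨ sym (trans (*-assoc L C (∏ₛ K S r)) (trans (cong (L *_) C*∏r≡1) (*-identityʳ L))) ⟩
    L * C * ∏ₛ K S r
      ≤⟨ *-monoˡ-≤-nonNeg (∏ₛ-nonNeg K S (λ k → <⇒≤ (0<r k))) LC≤1 ⟩
    1# * ∏ₛ K S r
      ≡⟨ *-identityˡ _ ⟩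
    ∏ₛ K S r ∎
    where
    open ≤-Reasoning
    c : Fin K → Carrier
    c k = 0<r k ⁻¹
    L = ∑ h (λ t → μ t * ∏ₛ K S (λ k → u k t))
    C = ∏ₛ K S c
    C*∏r≡1 : C * ∏ₛ K S r ≡ 1#
    C*∏r≡1 = trans (sym (∏ₛ-distrib-* K S c r))
             (trans (∏ₛ-cong K S (λ k _ → trans (*-comm (c k) (r k)) (*-inverseʳ (0<r k))))
             (trans (∏ₛ-const K S 1#) (1^n≡1 (countB K S))))
    unit : ∀ k → S k ≡ true → ∑ h (λ t → μ t * (u k t * c k) ^ suc b) ≡ 1#
    unit k Sk = begin-equality
      ∑ h (λ t → μ t * (u k t * c k) ^ suc b)
        ≡⟨ ∑-cong h (λ t → trans (cong (μ t *_) (^-distrib-* (u k t) (c k) (suc b)))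
                                 (sym (*-assoc (μ t) _ _))) ⟩
      ∑ h (λ t → μ t * u k t ^ suc b * c k ^ suc b)
        ≡⟨ sym (*-distribʳ-∑ h (c k ^ suc b) _) ⟩
      ∑ h (λ t → μ t * u k t ^ suc b) * c k ^ suc b
        ≡⟨ cong (_* c k ^ suc b) (norm≡rᵇ k Sk) ⟩
      r k ^ suc b * c k ^ suc b
        ≡⟨ trans (sym (^-distrib-* (r k) (c k) (suc b)))
                 (trans (cong (_^ suc b) (*-inverseʳ (0<r k))) (1^n≡1 (suc b))) ⟩
      1# ∎
    LC≤1 : L * C ≤ 1#
    LC≤1 = begin
      L * C
        ≡⟨ trans (*-distribʳ-∑ h C _) (∑-cong h (λ t → trans (*-assoc (μ t) _ C)
             (cong (μ t *_) (sym (∏ₛ-distrib-* K S (λ k → u k t) c))))) ⟩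
      ∑ h (λ t → μ t * ∏ₛ K S (λ k → u k t * c k))
        ≤⟨ hölder-unit-norms μ b K S (λ t k → u k t * c k) count 0≤μ
             (λ t k → *-nonNeg (0≤u k t) (<⇒≤ (⁻¹-pos (0<r k)))) unit ⟩
      1# ∎

  hölder : ∀ {h} (μ : Fin h → Carrier) b K S (u : Fin K → Fin h → Carrier) →
    countB K S ≡ suc b → (∀ t → 0# < μ t) → (∀ k t → 0# ≤ u k t) →
    ∑ h (λ t → μ t * ∏ₛ K S (λ k → u k t)) ≤ ∏ₛ K S (λ k → root b (∑ h (λ t → μ t * u k t ^ suc b)))
  hölder {h} μ b K S u count 0<μ 0≤u = by-cases (Finₚ.any? λ k → (S k Boolₚ.≟ true) ×-dec (ρ k ≟ 0#))
    where
    A : Fin K → Carrier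
    A k = ∑ h (λ t → μ t * u k t ^ suc b)
    0≤μuᵇ : ∀ k t → 0# ≤ μ t * u k t ^ suc b
    0≤μuᵇ k t = *-nonNeg (<⇒≤ (0<μ t)) (^-nonNeg (suc b) (0≤u k t))
    ρ : Fin K → Carrier
    ρ k = root b (A k)
    L = ∑ h (λ t → μ t * ∏ₛ K S (λ k → u k t))

    by-cases : Dec (Σ (Fin K) λ k → S k ≡ true × ρ k ≡ 0#) → L ≤ ∏ₛ K S ρ
    by-cases (yes (k , Sk , ρk≡0)) =
      subst (_≤ ∏ₛ K S ρ) (sym L≡0) (∏ₛ-nonNeg K S (λ k → root-nonNeg b (A k)))
      where
      Ak≡0 : A k ≡ 0#
      Ak≡0 = trans (sym (root-^ b (∑-nonNeg h (0≤μuᵇ k)))) (trans (cong (_^ suc b) ρk≡0) (0^suc≡0 b))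
      uk≡0 : ∀ t → u k t ≡ 0#
      uk≡0 t = ^≡0⇒≡0 (suc b) (0≤u k t)
                 (pos-*-nonNeg≡0 (0<μ t) (^-nonNeg (suc b) (0≤u k t)) (∑-nonNeg-≡0 h (0≤μuᵇ k) Ak≡0 t))
      L≡0 : L ≡ 0#
      L≡0 = trans (∑-cong h (λ t → trans (cong (μ t *_)
                    (∏-zero K k (trans (cong (λ s → if s then u k t else 1#) Sk) (uk≡0 t)))) (zeroʳ (μ t))))
                  (∑-zero h)
    by-cases (no no-zero) =
      subst (L ≤_) (∏ₛ-cong K S (λ k Sk → cong (λ s → if s then ρ k else 1#) Sk))
        (hölder-pos-norms μ b K S u ρ′ count (<⇒≤ ∘ 0<μ) 0≤u 0<ρ′ A≡ρ′ᵇ)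
      where
      ρ′ : Fin K → Carrier
      ρ′ k = if S k then ρ k else 1#
      0<ρ′ : ∀ k → 0# < ρ′ k
      0<ρ′ k with S k in Sk | root-nonNeg b (A k)
      ... | false | _ = 0<1
      ... | true | inj₁ 0<ρk = 0<ρk
      ... | true | inj₂ 0≡ρk = ⊥-elim (no-zero (k , Sk , sym 0≡ρk))
      A≡ρ′ᵇ : ∀ k → S k ≡ true → A k ≡ ρ′ k ^ suc b
      A≡ρ′ᵇ k Sk = trans (sym (root-^ b (∑-nonNeg h (0≤μuᵇ k))))
                         (cong (λ s → (if s then ρ k else 1#) ^ suc b) (sym Sk))

module Finner (R : CompleteOrderedField) where
  open Hölder R public

  DependsOnlyOn : ∀ {n h} → (Fin n → Bool) → ((Fin n → Fin h) → Carrier) → Set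
  DependsOnlyOn S F = ∀ x y → (∀ o → S o ≡ true → x o ≡ y o) → F x ≡ F y

  DependsOnlyOn-extensional : ∀ {n h} S (F : (Fin n → Fin h) → Carrier) → DependsOnlyOn S F → Extensional F
  DependsOnlyOn-extensional S F dep x y x≗y = dep x y (λ o _ → x≗y o)

  DependsOnlyOn-∷ : ∀ {n h} S (F : (Fin (suc n) → Fin h) → Carrier) → DependsOnlyOn S F → ∀ t →
                    DependsOnlyOn (λ o → S (suc o)) (λ x → F (t ∷ x))
  DependsOnlyOn-∷ S F dep t x y agree = dep (t ∷ x) (t ∷ y) λ { zero _ → refl ; (suc o) So → agree o So }

  DependsOnlyOn-skip : ∀ {n h} S (F : (Fin (suc n) → Fin h) → Carrier) → DependsOnlyOn S F → S zero ≡ false →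
                       ∀ t u x → F (t ∷ x) ≡ F (u ∷ x)
  DependsOnlyOn-skip S F dep S₀≡false t u x =
    dep (t ∷ x) (u ∷ x) λ where
      zero S₀≡true → contradiction (trans (sym S₀≡false) S₀≡true) λ ()
      (suc o) _ → refl

  module _ {h} (μ : Fin (suc h) → Carrier) where

    W : ∀ n → (Fin n → Fin (suc h)) → Carrier
    W n x = ∏ n (λ o → μ (x o))

    m : Carrier
    m = ∑ (suc h) μ

    ∑Fun-W-suc : ∀ n (Ψ : (Fin (suc n) → Fin (suc h)) → Carrier) → Extensional Ψ →
      ∑Fun (suc n) (suc h) (λ x → W (suc n) x * Ψ x)
        ≡ ∑Fun n (suc h) (λ x → W n x * ∑ (suc h) (λ t → μ t * Ψ (t ∷ x)))
    ∑Fun-W-suc n Ψ Ψ-ext = begin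
      ∑Fun (suc n) (suc h) (λ x → W (suc n) x * Ψ x)
        ≡⟨ ∑Fun-suc n (suc h) _ (λ x y x≗y →
             cong₂ _*_ (∏-cong (suc n) (λ o → cong μ (x≗y o))) (Ψ-ext x y x≗y)) ⟩
      ∑ (suc h) (λ t → ∑Fun n (suc h) (λ x → μ t * W n x * Ψ (t ∷ x)))
        ≡⟨ sym (∑Fun-∑ n (suc h) (suc h) (λ t x → μ t * W n x * Ψ (t ∷ x))) ⟩
      ∑Fun n (suc h) (λ x → ∑ (suc h) (λ t → μ t * W n x * Ψ (t ∷ x)))
        ≡⟨ ∑Fun-cong n (suc h) (λ x → trans
             (∑-cong (suc h) (λ t → solve 3 (λ a b c → a :* b :* c := b :* (a :* c)) refl (μ t) (W n x) (Ψ (t ∷ x))))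
             (sym (*-distribˡ-∑ (suc h) (W n x) (λ t → μ t * Ψ (t ∷ x))))) ⟩
      ∑Fun n (suc h) (λ x → W n x * ∑ (suc h) (λ t → μ t * Ψ (t ∷ x))) ∎
      where open ≡-Reasoning

    -- Integrating out the first coordinate: a factor whose set contains it is replaced by its
    -- L^(b+1)(μ)-norm in that coordinate, and the other factors do not depend on it.
    collapse : ∀ b {n} → ((Fin (suc n) → Fin (suc h)) → Carrier) → Bool → (Fin n → Fin (suc h)) → Carrier
    collapse b f τ x = if τ then root b (∑ (suc h) (λ t → μ t * f (t ∷ x) ^ suc b)) else f (zero ∷ x)

    collapse-nonNeg : ∀ b {n} (f : (Fin (suc n) → Fin (suc h)) → Carrier) τ → (∀ x → 0# ≤ f x) →
                      ∀ x → 0# ≤ collapse b f τ x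
    collapse-nonNeg b f τ 0≤f x = if-nonNeg τ (root-nonNeg b _) (0≤f (zero ∷ x))

    collapse-dependsOnlyOn : ∀ b {n} S (f : (Fin (suc n) → Fin (suc h)) → Carrier) → DependsOnlyOn S f →
                             DependsOnlyOn (λ o → S (suc o)) (collapse b f (S zero))
    collapse-dependsOnlyOn b S f dep x y agree = cong₂ (λ u v → if S zero then root b u else v)
      (∑-cong (suc h) (λ t → cong (λ z → μ t * z ^ suc b) (DependsOnlyOn-∷ S f dep t x y agree)))
      (DependsOnlyOn-∷ S f dep zero x y agree)

    module _ (0<μ : ∀ t → 0# < μ t) where

      0≤W : ∀ n x → 0# ≤ W n x
      0≤W n x = ∏-nonNeg n (λ o → <⇒≤ (0<μ (x o)))

      collapse-bound : ∀ b {n} K (F : Fin K → (Fin (suc n) → Fin (suc h)) → Carrier)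
                       (S : Fin K → Fin (suc n) → Bool) →
        (∀ k x → 0# ≤ F k x) → (∀ k → DependsOnlyOn (S k) (F k)) → countB K (λ k → S k zero) ≡ suc b →
        ∀ x → ∑ (suc h) (λ t → μ t * ∏ K (λ k → F k (t ∷ x))) ≤ ∏ K (λ k → collapse b (F k) (S k zero) x)
      collapse-bound b K F S 0≤F dep count x = begin
        ∑ (suc h) (λ t → μ t * ∏ K (λ k → F k (t ∷ x)))
          ≡⟨ ∑-cong (suc h) (λ t → cong (μ t *_) (trans (∏-∏ₛ-split K T _) (cong (Fₜ t *_) (untagged t)))) ⟩
        ∑ (suc h) (λ t → μ t * (Fₜ t * Q))
          ≡⟨ trans (∑-cong (suc h) (λ t → sym (*-assoc (μ t) (Fₜ t) Q)))
                   (sym (*-distribʳ-∑ (suc h) Q (λ t → μ t * Fₜ t))) ⟩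
        ∑ (suc h) (λ t → μ t * Fₜ t) * Q
          ≤⟨ *-monoˡ-≤-nonNeg (∏ₛ-nonNeg K (not ∘ T) (λ k → 0≤F k (zero ∷ x)))
                              (hölder μ b K T (λ k t → F k (t ∷ x)) count 0<μ (λ k t → 0≤F k (t ∷ x))) ⟩
        ∏ₛ K T (λ k → root b (∑ (suc h) (λ t → μ t * F k (t ∷ x) ^ suc b))) * Q
          ≡⟨ cong₂ _*_ (∏ₛ-cong K T (λ k Tk → sym (cong (λ s → if s then _ else F k (zero ∷ x)) Tk)))
                       (∏ₛ-cong K (not ∘ T) (λ k ¬Tk →
                          sym (cong (λ s → if s then _ else F k (zero ∷ x)) (untagged-false ¬Tk)))) ⟩
        ∏ₛ K T (λ k → collapse b (F k) (T k) x) * ∏ₛ K (not ∘ T) (λ k → collapse b (F k) (T k) x)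
          ≡⟨ sym (∏-∏ₛ-split K T _) ⟩
        ∏ K (λ k → collapse b (F k) (T k) x) ∎
        where
        open ≤-Reasoning
        T : Fin K → Bool
        T k = S k zero
        Fₜ : Fin (suc h) → Carrier
        Fₜ t = ∏ₛ K T (λ k → F k (t ∷ x))
        Q = ∏ₛ K (not ∘ T) (λ k → F k (zero ∷ x))
        untagged-false : ∀ {k} → not (T k) ≡ true → T k ≡ false
        untagged-false = Boolₚ.not-injective {y = false}
        untagged : ∀ t → ∏ₛ K (not ∘ T) (λ k → F k (t ∷ x)) ≡ Q
        untagged t = ∏ₛ-cong K (not ∘ T) (λ k ¬Tk →
                       DependsOnlyOn-skip (S k) (F k) (dep k) (untagged-false ¬Tk) t zero x)

      collapse-∑Fun-bound : ∀ b n K (F : Fin K → (Fin (suc n) → Fin (suc h)) → Carrier)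
                            (S : Fin K → Fin (suc n) → Bool) →
        (∀ k x → 0# ≤ F k x) → (∀ k → DependsOnlyOn (S k) (F k)) → countB K (λ k → S k zero) ≡ suc b →
        ∑Fun (suc n) (suc h) (λ x → W (suc n) x * ∏ K (λ k → F k x))
          ≤ ∑Fun n (suc h) (λ x → W n x * ∏ K (λ k → collapse b (F k) (S k zero) x))
      collapse-∑Fun-bound b n K F S 0≤F dep count = ≤-trans
        (≤-reflexive (∑Fun-W-suc n (λ x → ∏ K (λ k → F k x))
          (λ x y x≗y → ∏-cong K (λ k → DependsOnlyOn-extensional (S k) (F k) (dep k) x y x≗y))))
        (∑Fun-mono-≤ n (suc h) (λ x → *-monoʳ-≤-nonNeg (0≤W n x) (collapse-bound b K F S 0≤F dep count x)))

      collapse-norm : ∀ b {n} (S : Fin (suc n) → Bool) (f : (Fin (suc n) → Fin (suc h)) → Carrier) →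
        (∀ x → 0# ≤ f x) → DependsOnlyOn S f →
        ∑Fun (suc n) (suc h) (λ x → W (suc n) x * f x ^ suc b) * m ^ countB (suc n) S
          ≡ ∑Fun n (suc h) (λ x → W n x * collapse b f (S zero) x ^ suc b) * m ^ countB n (S ∘ suc) * m
      collapse-norm b {n} S f 0≤f dep = begin
        ∑Fun (suc n) (suc h) (λ x → W (suc n) x * f x ^ suc b)
          * m ^ ((if S zero then 1 else 0) ℕ.+ countB n (S ∘ suc))
          ≡⟨ cong₂ _*_ (∑Fun-W-suc n (λ x → f x ^ suc b)
                         (λ x y x≗y → cong (_^ suc b) (DependsOnlyOn-extensional S f dep x y x≗y)))
                       (^-homo-* m (if S zero then 1 else 0) (countB n (S ∘ suc))) ⟩
        I * (m ^ (if S zero then 1 else 0) * m ^ countB n (S ∘ suc))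
          ≡⟨ solve 3 (λ a u v → a :* (u :* v) := a :* u :* v) refl I _ _ ⟩
        I * m ^ (if S zero then 1 else 0) * m ^ countB n (S ∘ suc)
          ≡⟨ cong (_* m ^ countB n (S ∘ suc)) (by-cases (S zero) refl) ⟩
        N′ * m * m ^ countB n (S ∘ suc)
          ≡⟨ solve 3 (λ a u v → a :* u :* v := a :* v :* u) refl N′ m (m ^ countB n (S ∘ suc)) ⟩
        N′ * m ^ countB n (S ∘ suc) * m ∎
        where
        open ≡-Reasoning
        I = ∑Fun n (suc h) (λ x → W n x * ∑ (suc h) (λ t → μ t * f (t ∷ x) ^ suc b))
        N′ = ∑Fun n (suc h) (λ x → W n x * collapse b f (S zero) x ^ suc b)
        by-cases : ∀ τ → S zero ≡ τ → I * m ^ (if τ then 1 else 0) ≡ N′ * m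
        by-cases true S₀≡true = cong₂ _*_
          (∑Fun-cong n (suc h) (λ x → cong (W n x *_) (trans
            (sym (root-^ b (∑-nonNeg (suc h) (λ t → *-nonNeg (<⇒≤ (0<μ t)) (^-nonNeg (suc b) (0≤f (t ∷ x)))))))
            (cong (λ s → (if s then _ else f (zero ∷ x)) ^ suc b) (sym S₀≡true)))))
          (*-identityʳ m)
        by-cases false S₀≡false = begin
          I * 1#
            ≡⟨ *-identityʳ I ⟩
          I
            ≡⟨ ∑Fun-cong n (suc h) (λ x → cong (W n x *_) (trans
                 (∑-cong (suc h) (λ t →
                    cong (λ z → μ t * z ^ suc b) (DependsOnlyOn-skip S f dep S₀≡false t zero x)))
                 (sym (*-distribʳ-∑ (suc h) (f (zero ∷ x) ^ suc b) μ)))) ⟩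
          ∑Fun n (suc h) (λ x → W n x * (m * f (zero ∷ x) ^ suc b))
            ≡⟨ ∑Fun-cong n (suc h) (λ x →
                 solve 3 (λ w m c → w :* (m :* c) := m :* (w :* c)) refl (W n x) m (f (zero ∷ x) ^ suc b)) ⟩
          ∑Fun n (suc h) (λ x → m * (W n x * f (zero ∷ x) ^ suc b))
            ≡⟨ trans (sym (*-distribˡ-∑Fun n (suc h) m _)) (*-comm m _) ⟩
          ∑Fun n (suc h) (λ x → W n x * f (zero ∷ x) ^ suc b) * m
            ≡⟨ cong (_* m) (∑Fun-cong n (suc h) (λ x →
                 cong (λ s → W n x * (if s then _ else f (zero ∷ x)) ^ suc b) (sym S₀≡false))) ⟩
          N′ * m ∎

      -- Finner's inequality ∫ ∏ F k ≤ ∏ ‖F k‖_(b+1), for the product measure μⁿ of total mass mⁿ.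
      finner : ∀ b n K (F : Fin K → (Fin n → Fin (suc h)) → Carrier) (S : Fin K → Fin n → Bool) →
        (∀ k x → 0# ≤ F k x) → (∀ k → DependsOnlyOn (S k) (F k)) → (∀ o → countB K (λ k → S k o) ≡ suc b) →
        ∑Fun n (suc h) (λ x → W n x * ∏ K (λ k → F k x)) ^ suc b * (m ^ n) ^ K
          ≤ ∏ K (λ k → ∑Fun n (suc h) (λ x → W n x * F k x ^ suc b) * m ^ countB n (S k))
      finner b zero K F S 0≤F dep count = ≤-reflexive (empty-product _)
        where
        open ≡-Reasoning
        empty-product : ∀ x₀ →
          (1# * ∏ K (λ k → F k x₀)) ^ suc b * 1# ^ K ≡ ∏ K (λ k → 1# * F k x₀ ^ suc b * 1#)
        empty-product x₀ = begin
          (1# * ∏ K (λ k → F k x₀)) ^ suc b * 1# ^ K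
            ≡⟨ cong₂ (λ u v → u ^ suc b * v) (*-identityˡ _) (1^n≡1 K) ⟩
          ∏ K (λ k → F k x₀) ^ suc b * 1#
            ≡⟨ trans (*-identityʳ _) (∏-^ K (λ k → F k x₀) (suc b)) ⟩
          ∏ K (λ k → F k x₀ ^ suc b)
            ≡⟨ ∏-cong K (λ k → sym (trans (*-identityʳ _) (*-identityˡ _))) ⟩
          ∏ K (λ k → 1# * F k x₀ ^ suc b * 1#) ∎
      finner b (suc n) K F S 0≤F dep count = begin
        A ^ suc b * (m ^ suc n) ^ K
          ≤⟨ *-monoˡ-≤-nonNeg (^-nonNeg K (^-nonNeg (suc n) 0≤m))
               (^-monoˡ-≤ (suc b) 0≤A (collapse-∑Fun-bound b n K F S 0≤F dep (count zero))) ⟩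
        A′ ^ suc b * (m * m ^ n) ^ K
          ≡⟨ cong (A′ ^ suc b *_) (^-distrib-* m (m ^ n) K) ⟩
        A′ ^ suc b * (m ^ K * (m ^ n) ^ K)
          ≡⟨ solve 3 (λ a u v → a :* (u :* v) := a :* v :* u) refl (A′ ^ suc b) (m ^ K) ((m ^ n) ^ K) ⟩
        A′ ^ suc b * (m ^ n) ^ K * m ^ K
          ≤⟨ *-monoˡ-≤-nonNeg (^-nonNeg K 0≤m) (finner b n K G (λ k → S k ∘ suc) 0≤G depG (count ∘ suc)) ⟩
        ∏ K (λ k → N′ k * m ^ countB n (S k ∘ suc)) * m ^ K
          ≡⟨ trans (cong (∏ K (λ k → N′ k * m ^ countB n (S k ∘ suc)) *_) (sym (∏-const K m)))
                   (sym (∏-distrib-* K _ _)) ⟩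
        ∏ K (λ k → N′ k * m ^ countB n (S k ∘ suc) * m)
          ≡⟨ ∏-cong K (λ k → sym (collapse-norm b (S k) (F k) (0≤F k) (dep k))) ⟩
        ∏ K (λ k → ∑Fun (suc n) (suc h) (λ x → W (suc n) x * F k x ^ suc b) * m ^ countB (suc n) (S k)) ∎
        where
        open ≤-Reasoning
        G : Fin K → (Fin n → Fin (suc h)) → Carrier
        G k = collapse b (F k) (S k zero)
        0≤G : ∀ k x → 0# ≤ G k x
        0≤G k = collapse-nonNeg b (F k) (S k zero) (0≤F k)
        depG : ∀ k → DependsOnlyOn (S k ∘ suc) (G k)
        depG k = collapse-dependsOnlyOn b (S k) (F k) (dep k)
        0≤m : 0# ≤ m
        0≤m = ∑-nonNeg (suc h) (<⇒≤ ∘ 0<μ)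
        A = ∑Fun (suc n) (suc h) (λ x → W (suc n) x * ∏ K (λ k → F k x))
        A′ = ∑Fun n (suc h) (λ x → W n x * ∏ K (λ k → G k x))
        0≤A : 0# ≤ A
        0≤A = ∑Fun-nonNeg (suc n) (suc h) (λ x → *-nonNeg (0≤W (suc n) x) (∏-nonNeg K (λ k → 0≤F k x)))
        N′ : Fin K → Carrier
        N′ k = ∑Fun n (suc h) (λ x → W n x * G k x ^ suc b)

module PartitionFunction (R : CompleteOrderedField) where
  open Finner R public

  ind : Bool → Carrier
  ind true = 1#
  ind false = 0#

  ind-nonNeg : ∀ s → 0# ≤ ind s
  ind-nonNeg true = 0≤1
  ind-nonNeg false = ≤-refl

  if-then-else-0 : ∀ s x → (if s then x else 0#) ≡ ind s * x
  if-then-else-0 true x = sym (*-identityˡ x)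
  if-then-else-0 false x = sym (zeroˡ x)

  ind-allB : ∀ n p → ind (allB n p) ≡ ∏ n (λ i → ind (p i))
  ind-allB zero p = refl
  ind-allB (suc n) p with p zero
  ... | true = trans (ind-allB n (p ∘ suc)) (sym (*-identityˡ _))
  ... | false = sym (zeroˡ _)

  ind-implies : ∀ s t → ind (not s ∨ t) ≡ (if s then ind t else 1#)
  ind-implies true t = refl
  ind-implies false t = refl

  module _ (H : Graph) (lam mu : Fin (size H) → Carrier) where

    -- L S x is the λ-weight of the colours available to a vertex of E with neighbourhood S
    -- when the vertices of O are coloured by x.
    L : ∀ {n} → (Fin n → Bool) → (Fin n → Fin (size H)) → Carrier
    L {n} S x = ∑ (size H) (λ i → lam i * ∏ₛ n S (λ o → ind (adjH H i (x o))))

    L-nonNeg : (∀ i → 0# < lam i) → ∀ {n} S x → 0# ≤ L {n} S x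
    L-nonNeg 0<lam {n} S x =
      ∑-nonNeg (size H) (λ i → *-nonNeg (<⇒≤ (0<lam i)) (∏ₛ-nonNeg n S (λ o → ind-nonNeg (adjH H i (x o)))))

    L-dependsOnlyOn : ∀ {n} S → DependsOnlyOn S (L {n} S)
    L-dependsOnlyOn {n} S x y agree =
      ∑-cong (size H) (λ i → cong (lam i *_) (∏ₛ-cong n S (λ o So → cong (λ t → ind (adjH H i t)) (agree o So))))

    hom-weight : ∀ G fE fO →
      (if isHom G H fE fO then ∏ (nE G) (λ e → lam (fE e)) * ∏ (nO G) (λ o → mu (fO o)) else 0#)
        ≡ ∏ (nO G) (λ o → mu (fO o))
          * ∏ (nE G) (λ e → lam (fE e) * ∏ₛ (nO G) (adj G e) (λ o → ind (adjH H (fE e) (fO o))))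
    hom-weight G fE fO = begin
      (if isHom G H fE fO then Λ * M else 0#)
        ≡⟨ if-then-else-0 (isHom G H fE fO) (Λ * M) ⟩
      ind (isHom G H fE fO) * (Λ * M)
        ≡⟨ cong (_* (Λ * M)) (trans (ind-allB (nE G) _) (∏-cong (nE G) (λ e →
             trans (ind-allB (nO G) _) (∏-cong (nO G) (λ o → ind-implies (adj G e o) _))))) ⟩
      ∏ (nE G) (λ e → ∏ₛ (nO G) (adj G e) (λ o → ind (adjH H (fE e) (fO o)))) * (Λ * M)
        ≡⟨ solve 3 (λ P Λ M → P :* (Λ :* M) := M :* (Λ :* P)) refl _ Λ M ⟩
      M * (Λ * ∏ (nE G) (λ e → ∏ₛ (nO G) (adj G e) (λ o → ind (adjH H (fE e) (fO o)))))
        ≡⟨ cong (M *_) (sym (∏-distrib-* (nE G) _ _)) ⟩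
      M * ∏ (nE G) (λ e → lam (fE e) * ∏ₛ (nO G) (adj G e) (λ o → ind (adjH H (fE e) (fO o)))) ∎
      where
      open ≡-Reasoning
      Λ = ∏ (nE G) (λ e → lam (fE e))
      M = ∏ (nO G) (λ o → mu (fO o))

    Z-by-O-labellings : ∀ G → Z R G H lam mu
      ≡ ∑Fun (nO G) (size H) (λ x → ∏ (nO G) (λ o → mu (x o)) * ∏ (nE G) (λ e → L (adj G e) x))
    Z-by-O-labellings G = begin
      Z R G H lam mu
        ≡⟨ ∑Fun-cong (nE G) (size H) (λ fE → ∑Fun-cong (nO G) (size H) (λ fO → hom-weight G fE fO)) ⟩
      ∑Fun (nE G) (size H) (λ fE → ∑Fun (nO G) (size H) (λ x → M x * ∏ (nE G) (λ e → φ x e (fE e))))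
        ≡⟨ ∑Fun-comm (nE G) (nO G) (size H) _ ⟩
      ∑Fun (nO G) (size H) (λ x → ∑Fun (nE G) (size H) (λ fE → M x * ∏ (nE G) (λ e → φ x e (fE e))))
        ≡⟨ ∑Fun-cong (nO G) (size H) (λ x → trans (sym (*-distribˡ-∑Fun (nE G) (size H) (M x) _))
                                                 (cong (M x *_) (∑Fun-∏ (nE G) (size H) (φ x)))) ⟩
      ∑Fun (nO G) (size H) (λ x → M x * ∏ (nE G) (λ e → L (adj G e) x)) ∎
      where
      open ≡-Reasoning
      M : (Fin (nO G) → Fin (size H)) → Carrier
      M x = ∏ (nO G) (λ o → mu (x o))
      φ : (Fin (nO G) → Fin (size H)) → Fin (nE G) → Fin (size H) → Carrier
      φ x e i = lam i * ∏ₛ (nO G) (adj G e) (λ o → ind (adjH H i (x o)))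

    Z-nonNeg : (∀ i → 0# < lam i) → (∀ i → 0# < mu i) → ∀ G → 0# ≤ Z R G H lam mu
    Z-nonNeg 0<lam 0<mu G = subst (0# ≤_) (sym (Z-by-O-labellings G)) (∑Fun-nonNeg (nO G) (size H) (λ x →
      *-nonNeg (∏-nonNeg (nO G) (λ o → <⇒≤ (0<mu (x o)))) (∏-nonNeg (nE G) (λ e → L-nonNeg 0<lam (adj G e) x))))

    common-nbhd : ∀ {b} → (Fin b → Fin (size H)) → Carrier
    common-nbhd {b} v = ∑ (size H) (λ t → mu t * ∏ b (λ c → ind (adjH H (v c) t)))

    L-moment : ∀ b n S → ∑Fun n (size H) (λ x → ∏ n (λ o → mu (x o)) * L S x ^ b)
      ≡ ∑Fun b (size H) (λ v → ∏ b (λ c → lam (v c)) * ∏ n (λ o → if S o then common-nbhd v else ∑ (size H) mu))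
    L-moment b n S = begin
      ∑Fun n (size H) (λ x → M x * L S x ^ b)
        ≡⟨ ∑Fun-cong n (size H) (λ x → trans (cong (M x *_) (∑-^ b (size H) (φ x)))
                                            (*-distribˡ-∑Fun b (size H) (M x) _)) ⟩
      ∑Fun n (size H) (λ x → ∑Fun b (size H) (λ v → M x * ∏ b (λ c → φ x (v c))))
        ≡⟨ ∑Fun-comm n b (size H) _ ⟩
      ∑Fun b (size H) (λ v → ∑Fun n (size H) (λ x → M x * ∏ b (λ c → φ x (v c))))
        ≡⟨ ∑Fun-cong b (size H) (λ v → trans (∑Fun-cong n (size H) (separate v))
             (trans (sym (*-distribˡ-∑Fun n (size H) (Λ v) _))
                    (cong (Λ v *_) (trans (∑Fun-∏ n (size H) (λ o t → mu t * ψ v o t)) (∏-cong n (integrate v)))))) ⟩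
      ∑Fun b (size H) (λ v → Λ v * ∏ n (λ o → if S o then common-nbhd v else ∑ (size H) mu)) ∎
      where
      open ≡-Reasoning
      M : (Fin n → Fin (size H)) → Carrier
      M x = ∏ n (λ o → mu (x o))
      φ : (Fin n → Fin (size H)) → Fin (size H) → Carrier
      φ x i = lam i * ∏ₛ n S (λ o → ind (adjH H i (x o)))
      Λ : (Fin b → Fin (size H)) → Carrier
      Λ v = ∏ b (λ c → lam (v c))
      ψ : (Fin b → Fin (size H)) → Fin n → Fin (size H) → Carrier
      ψ v o t = if S o then ∏ b (λ c → ind (adjH H (v c) t)) else 1#
      separate : ∀ v x → M x * ∏ b (λ c → φ x (v c)) ≡ Λ v * ∏ n (λ o → mu (x o) * ψ v o (x o))
      separate v x = begin
        M x * ∏ b (λ c → φ x (v c))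
          ≡⟨ cong (M x *_) (∏-distrib-* b _ _) ⟩
        M x * (Λ v * ∏ b (λ c → ∏ₛ n S (λ o → ind (adjH H (v c) (x o)))))
          ≡⟨ cong (λ z → M x * (Λ v * z)) (∏-∏ₛ-comm b n S _) ⟩
        M x * (Λ v * ∏ₛ n S (λ o → ∏ b (λ c → ind (adjH H (v c) (x o)))))
          ≡⟨ solve 3 (λ M Λ P → M :* (Λ :* P) := Λ :* (M :* P)) refl (M x) (Λ v) _ ⟩
        Λ v * (M x * ∏ n (λ o → ψ v o (x o)))
          ≡⟨ cong (Λ v *_) (sym (∏-distrib-* n _ _)) ⟩
        Λ v * ∏ n (λ o → mu (x o) * ψ v o (x o)) ∎
      integrate : ∀ v o → ∑ (size H) (λ t → mu t * ψ v o t) ≡ (if S o then common-nbhd v else ∑ (size H) mu)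
      integrate v o with S o
      ... | true = refl
      ... | false = ∑-cong (size H) (λ t → *-identityʳ (mu t))

    Z-K : ∀ a b → Z R (K a b) H lam mu ≡ ∑Fun b (size H) (λ v → ∏ b (λ c → lam (v c)) * common-nbhd v ^ a)
    Z-K a b = begin
      Z R (K a b) H lam mu
        ≡⟨ Z-by-O-labellings (K a b) ⟩
      ∑Fun a (size H) (λ x → ∏ a (λ o → mu (x o)) * ∏ b (λ _ → L (λ _ → true) x))
        ≡⟨ ∑Fun-cong a (size H) (λ x → cong (∏ a (λ o → mu (x o)) *_) (∏-const b _)) ⟩
      ∑Fun a (size H) (λ x → ∏ a (λ o → mu (x o)) * L (λ _ → true) x ^ b)
        ≡⟨ L-moment b a (λ _ → true) ⟩
      ∑Fun b (size H) (λ v → ∏ b (λ c → lam (v c)) * ∏ a (λ _ → common-nbhd v))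
        ≡⟨ ∑Fun-cong b (size H) (λ v → cong (∏ b (λ c → lam (v c)) *_) (∏-const a _)) ⟩
      ∑Fun b (size H) (λ v → ∏ b (λ c → lam (v c)) * common-nbhd v ^ a) ∎
      where open ≡-Reasoning

    L-moment-K : ∀ b n S → ∑Fun n (size H) (λ x → ∏ n (λ o → mu (x o)) * L S x ^ b) * ∑ (size H) mu ^ countB n S
                             ≡ Z R (K (countB n S) b) H lam mu * ∑ (size H) mu ^ n
    L-moment-K b n S = begin
      ∑Fun n (size H) (λ x → ∏ n (λ o → mu (x o)) * L S x ^ b) * mass ^ c
        ≡⟨ trans (cong (_* mass ^ c) (L-moment b n S))
                 (trans (*-comm _ (mass ^ c)) (*-distribˡ-∑Fun b (size H) (mass ^ c) _)) ⟩
      ∑Fun b (size H) (λ v → mass ^ c * (Λ v * ∏ n (λ o → if S o then common-nbhd v else mass)))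
        ≡⟨ ∑Fun-cong b (size H) (λ v → begin
             mass ^ c * (Λ v * ∏ n (λ o → if S o then common-nbhd v else mass))
               ≡⟨ solve 3 (λ mᶜ Λ P → mᶜ :* (Λ :* P) := Λ :* (P :* mᶜ)) refl (mass ^ c) (Λ v) _ ⟩
             Λ v * (∏ n (λ o → if S o then common-nbhd v else mass) * mass ^ c)
               ≡⟨ cong (Λ v *_) (∏-if-const n S (common-nbhd v) mass) ⟩
             Λ v * (common-nbhd v ^ c * mass ^ n)
               ≡⟨ sym (*-assoc (Λ v) _ _) ⟩
             Λ v * common-nbhd v ^ c * mass ^ n ∎) ⟩
      ∑Fun b (size H) (λ v → Λ v * common-nbhd v ^ c * mass ^ n)
        ≡⟨ trans (∑Fun-cong b (size H) (λ v → *-comm _ (mass ^ n)))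
                 (sym (*-distribˡ-∑Fun b (size H) (mass ^ n) _)) ⟩
      mass ^ n * ∑Fun b (size H) (λ v → Λ v * common-nbhd v ^ c)
        ≡⟨ trans (*-comm (mass ^ n) _) (cong (_* mass ^ n) (sym (Z-K c b))) ⟩
      Z R (K c b) H lam mu * mass ^ n ∎
      where
      open ≡-Reasoning
      mass = ∑ (size H) mu
      c = countB n S
      Λ : (Fin b → Fin (size H)) → Carrier
      Λ v = ∏ b (λ c → lam (v c))

module DoubleCounting where
  open CommutativeMonoidSum ℕₚ.+-0-commutativeMonoid using (sum; sum-cong-≗; ∑-comm)

  countB≡sum : ∀ n p → countB n p ≡ sum (λ i → if p i then 1 else 0)
  countB≡sum zero p = refl
  countB≡sum (suc n) p = cong ((if p zero then 1 else 0) ℕ.+_) (countB≡sum n (p ∘ suc))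

  sum-const : ∀ n c → sum {n} (λ _ → c) ≡ n ℕ.* c
  sum-const zero c = refl
  sum-const (suc n) c = cong (c ℕ.+_) (sum-const n c)

  edge-count : ∀ nE nO (adj : Fin nE → Fin nO → Bool) a b →
               (∀ e → countB nO (adj e) ≡ a) → (∀ o → countB nE (λ e → adj e o) ≡ b) → nE ℕ.* a ≡ nO ℕ.* b
  edge-count nE nO adj a b deg-E deg-O = begin
    nE ℕ.* a
      ≡⟨ sym (sum-const nE a) ⟩
    sum {nE} (λ _ → a)
      ≡⟨ sum-cong-≗ (λ e → trans (sym (deg-E e)) (countB≡sum nO (adj e))) ⟩
    sum (λ e → sum (λ o → if adj e o then 1 else 0))
      ≡⟨ ∑-comm (λ e o → if adj e o then 1 else 0) ⟩
    sum (λ o → sum (λ e → if adj e o then 1 else 0))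
      ≡⟨ sum-cong-≗ (λ o → trans (sym (countB≡sum nE (λ e → adj e o))) (deg-O o)) ⟩
    sum {nO} (λ _ → b)
      ≡⟨ sum-const nO b ⟩
    nO ℕ.* b ∎
    where open ≡-Reasoning

  vertex-count : ∀ nE nO a b → nE ℕ.* a ≡ nO ℕ.* b → nE ℕ.* (a ℕ.+ b) ≡ (nE ℕ.+ nO) ℕ.* b
  vertex-count nE nO a b nEa≡nOb = begin
    nE ℕ.* (a ℕ.+ b)           ≡⟨ ℕₚ.*-distribˡ-+ nE a b ⟩
    nE ℕ.* a ℕ.+ nE ℕ.* b      ≡⟨ cong (ℕ._+ nE ℕ.* b) nEa≡nOb ⟩
    nO ℕ.* b ℕ.+ nE ℕ.* b      ≡⟨ sym (ℕₚ.*-distribʳ-+ b nO nE) ⟩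
    (nO ℕ.+ nE) ℕ.* b          ≡⟨ cong (ℕ._* b) (ℕₚ.+-comm nO nE) ⟩
    (nE ℕ.+ nO) ℕ.* b          ∎
    where open ≡-Reasoning

module Main (R : CompleteOrderedField) where
  open PartitionFunction R public

  ^-rescale : ∀ b {x y} p q r → 0# ≤ x → 0# ≤ y →
              x ^ suc b ≤ y ^ p → p ℕ.* r ≡ q ℕ.* suc b → x ^ r ≤ y ^ q
  ^-rescale b {x} {y} p q r 0≤x 0≤y xᵇ≤yᵖ pr≡qb = ^-cancelˡ-≤ b (^-nonNeg q 0≤y) (begin
    (x ^ r) ^ suc b
      ≡⟨ trans (^-assocʳ x r (suc b)) (trans (cong (x ^_) (ℕₚ.*-comm r (suc b))) (sym (^-assocʳ x (suc b) r))) ⟩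
    (x ^ suc b) ^ r
      ≤⟨ ^-monoˡ-≤ r (^-nonNeg (suc b) 0≤x) xᵇ≤yᵖ ⟩
    (y ^ p) ^ r
      ≡⟨ trans (^-assocʳ y p r) (trans (cong (y ^_) pr≡qb) (sym (^-assocʳ y q (suc b)))) ⟩
    (y ^ q) ^ suc b ∎)
    where open ≤-Reasoning

  -- The case of a graph H without vertices, where the total mass ∑ μ vanishes.
  empty-target-bound : ∀ b nO nE (mu : Fin 0 → Carrier) {Y} → 0# ≤ Y →
    ∑Fun nO 0 (λ x → ∏ nO (λ o → mu (x o)) * ∏ nE (λ _ → 0#)) ^ suc b ≤ Y ^ nE
  empty-target-bound b (suc nO) nE mu {Y} 0≤Y = subst (_≤ Y ^ nE) (sym (0^suc≡0 b)) (^-nonNeg nE 0≤Y)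
  empty-target-bound b zero (suc nE) mu {Y} 0≤Y =
    subst (_≤ Y ^ suc nE) (sym (trans (cong (_^ suc b) (trans (*-identityˡ _) (zeroˡ _))) (0^suc≡0 b)))
          (^-nonNeg (suc nE) 0≤Y)
  empty-target-bound b zero zero mu 0≤Y = ≤-reflexive (trans (cong (_^ suc b) (*-identityˡ 1#)) (1^n≡1 (suc b)))

  Z-biregular-bound : ∀ a b G → IsBiregular a (suc b) G →
                      ∀ H lam mu → (∀ i → 0# < lam i) → (∀ i → 0# < mu i) →
                      Z R G H lam mu ^ suc b ≤ Z R (K a (suc b)) H lam mu ^ nE G
  Z-biregular-bound a b G (deg-E , deg-O) H@(record { size = suc h }) lam mu 0<lam 0<mu =
    *-cancelʳ-≤-pos (^-pos (nE G) (^-pos (nO G) 0<m)) (begin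
      X ^ suc b * (m mu ^ nO G) ^ nE G
        ≡⟨ cong (λ z → z ^ suc b * (m mu ^ nO G) ^ nE G) (Z-by-O-labellings H lam mu G) ⟩
      ∑Fun (nO G) (suc h) (λ x → W mu (nO G) x * ∏ (nE G) (λ e → L H lam mu (adj G e) x)) ^ suc b
        * (m mu ^ nO G) ^ nE G
        ≤⟨ finner mu 0<mu b (nO G) (nE G) (λ e → L H lam mu (adj G e)) (adj G)
                  (λ e → L-nonNeg H lam mu 0<lam (adj G e)) (λ e → L-dependsOnlyOn H lam mu (adj G e)) deg-O ⟩
      ∏ (nE G) (λ e → ∑Fun (nO G) (suc h) (λ x → W mu (nO G) x * L H lam mu (adj G e) x ^ suc b)
                        * m mu ^ countB (nO G) (adj G e))
        ≡⟨ ∏-cong (nE G) (λ e → trans (L-moment-K H lam mu (suc b) (nO G) (adj G e))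
                                       (cong (λ c → Z R (K c (suc b)) H lam mu * m mu ^ nO G) (deg-E e))) ⟩
      ∏ (nE G) (λ _ → Y * m mu ^ nO G)
        ≡⟨ trans (∏-const (nE G) _) (^-distrib-* Y (m mu ^ nO G) (nE G)) ⟩
      Y ^ nE G * (m mu ^ nO G) ^ nE G ∎)
    where
    open ≤-Reasoning
    X = Z R G H lam mu
    Y = Z R (K a (suc b)) H lam mu
    0<m : 0# < m mu
    0<m = <-≤-trans (0<mu zero) (term≤∑ (suc h) (<⇒≤ ∘ 0<mu) zero)
  Z-biregular-bound a b G deg H@(record { size = zero }) lam mu 0<lam 0<mu =
    subst (λ z → z ^ suc b ≤ Z R (K a (suc b)) H lam mu ^ nE G) (sym (Z-by-O-labellings H lam mu G))
          (empty-target-bound b (nO G) (nE G) mu (Z-nonNeg H lam mu 0<lam 0<mu (K a (suc b))))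

open import Data.Nat using (_≥_; _+_)
open import Defs using (_^_)

proposition1p10 : (R : CompleteOrderedField) → (a b : ℕ) → a ≥ 1 → b ≥ 1 →
    (G : BipGraph) → IsBiregular a b G →
    (H : Graph) →
    (lam mu : Fin (size H) → CompleteOrderedField.Carrier R) →
    (∀ i → CompleteOrderedField._<_ R (CompleteOrderedField.0# R) (lam i)) →
    (∀ i → CompleteOrderedField._<_ R (CompleteOrderedField.0# R) (mu i)) →
    CompleteOrderedField._≤_ R
      (_^_ R (Z R G H lam mu) (a + b))
      (_^_ R (Z R (K a b) H lam mu) (∣V∣ G))
proposition1p10 R a (suc b) _ (s≤s z≤n) G deg@(deg-E , deg-O) H lam mu 0<lam 0<mu =
  ^-rescale b (nE G) (∣V∣ G) (a + suc b) (Z-nonNeg H lam mu 0<lam 0<mu G) (Z-nonNeg H lam mu 0<lam 0<mu (K a (suc b)))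
    (Z-biregular-bound a b G deg H lam mu 0<lam 0<mu)
    (vertex-count (nE G) (nO G) a (suc b) (edge-count (nE G) (nO G) (adj G) a (suc b) deg-E deg-O))
  where
  open Main R using (^-rescale; Z-nonNeg; Z-biregular-bound)
  open DoubleCounting using (edge-count; vertex-count)
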